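{- Let $f(t)=\sum_{k\ge1}\frac{c_k}{k!}t^k$ with $c_1\ne0$, $g(t)=t/f(t)=\sum_{k\ge0}\frac{a_k}{k!}t^k$, let $P=\sum_T P(T)(t)\,T\in\mathcal{T}[t]$ be the solution of $P'=\langle g(D)|P\rangle\curvearrowright P$, $P(0)=\bullet$, and set $p(T)(t)=|\mathrm{Aut}(T)|\cdot P(T)(t)$ for every rooted tree $T$. Then $p(\bullet)(t)=1$ and: (I) for rooted trees $T_1,\ldots,T_k$, $k\ge1$: $p(\{T_1,\ldots,T_k|\bullet\})=p(\{T_1|\bullet\})\cdots p(\{T_k|\bullet\})$; (II) for every rooted tree $T$: $p(\{T|\bullet\})(t)=\int_0^t g(D)p(T)(\tau)\,d\tau$. These relations determine all the polynomials $p(T)(t)$.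
   Context: $\mathbb{K}$ is a field of characteristic zero. A rooted tree is a finite (non-planar) tree with a distinguished root; $\mathrm{Aut}(T)$ is its group of root-preserving automorphisms. $\mathcal{T}=\prod_{n\ge1}\mathcal{T}(n)$, where $\mathcal{T}(n)$ is spanned by isomorphism classes of rooted trees with $n$ vertices; $T\curvearrowright T'=\sum_{v\in V(T')}T\searrow_vT'$, where $T\searrow_vT'$ adds an edge from the root of $T$ to the vertex $v$ of $T'$ and keeps the root of $T'$. $\bullet$ is the one-vertex tree; for rooted trees $T_1,\ldots,T_k$, $\{T_1,\ldots,T_k|\bullet\}$ denotes the rooted tree obtained by taking a new root vertex and joining it by an edge to the root of each $T_i$. $\mathcal{T}[t]$ consists of formal sums $\sum_TP(T)(t)T$ with polynomial coefficients, with $\curvearrowright$ extended $\mathbb{K}[t]$-bilinearly and derivative taken coefficientwise. $\langle g(D)|\cdot\rangle$ is the functional $t^n\mapsto a_n$ extended coefficientwise. $g(D)\colon\mathbb{K}[t]\to\mathbb{K}[t]$ is the linear operator $t^n\mapsto a_n(t):=\sum_{j=0}^n\binom{n}{j}a_{n-j}t^j$. -}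

module Defs where

open import Level using (Level; _⊔_) renaming (suc to lsuc)
open import Algebra.Bundles using (CommutativeRing)
open import Data.Nat using (ℕ; zero; suc; _∸_; _≡ᵇ_)
import Data.Nat as N
open import Data.Nat.Combinatorics using (_C_)
open import Data.Bool using (Bool; true; false; not; if_then_else_)
open import Data.List using (List; []; _∷_; _++_; map; concatMap; upTo; zipWith; length; foldr; deduplicateᵇ)
open import Relation.Nullary using (¬_)
open import Relation.Binary.PropositionalEquality using (_≡_)

record Field (c ℓ : Level) : Set (lsuc (c ⊔ ℓ)) where
  field
    commutativeRing : CommutativeRing c ℓ
  open CommutativeRing commutativeRing public
  field
    _⁻¹        : Carrier → Carrier
    ⁻¹-inverse : ∀ x → ¬ (x ≈ 0#) → x * (x ⁻¹) ≈ 1#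
    0≉1        : ¬ (0# ≈ 1#)

module FieldOps {c ℓ : Level} (F : Field c ℓ) where
  open Field F

  ι : ℕ → Carrier
  ι zero    = 0#
  ι (suc n) = 1# + ι n

  sumK : List Carrier → Carrier
  sumK = foldr _+_ 0#

  -- Polynomials K[t] as coefficient lists (index i = coefficient of t^i)

  Poly : Set c
  Poly = List Carrier

  coeff : Poly → ℕ → Carrier
  coeff []      _       = 0#
  coeff (x ∷ p) zero    = x
  coeff (x ∷ p) (suc n) = coeff p n

  _≈ₚ_ : Poly → Poly → Set ℓ
  p ≈ₚ q = ∀ n → coeff p n ≈ coeff q n

  _⊕_ : Poly → Poly → Poly
  []      ⊕ q       = q
  (x ∷ p) ⊕ []      = x ∷ p
  (x ∷ p) ⊕ (y ∷ q) = (x + y) ∷ (p ⊕ q)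

  scale : Carrier → Poly → Poly
  scale k p = map (k *_) p

  _⊗_ : Poly → Poly → Poly
  []      ⊗ q = []
  (x ∷ p) ⊗ q = scale x q ⊕ (0# ∷ (p ⊗ q))

  onePoly : Poly
  onePoly = 1# ∷ []

  sumP : List Poly → Poly
  sumP = foldr _⊕_ []

  prodP : List Poly → Poly
  prodP = foldr _⊗_ onePoly

  eval : Poly → Carrier → Carrier
  eval []      x = 0#
  eval (k ∷ p) x = k + x * eval p x

  deriv : Poly → Poly
  deriv []      = []
  deriv (_ ∷ p) = zipWith (λ i k → ι (suc i) * k) (upTo (length p)) p

  integ : Poly → Poly
  integ p = 0# ∷ zipWith (λ i k → (ι (suc i)) ⁻¹ * k) (upTo (length p)) p

  -- Operators attached to a sequence a (the EGF coefficients of g)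

  aPoly : (ℕ → Carrier) → ℕ → Poly
  aPoly a n = map (λ j → ι (n C j) * a (n ∸ j)) (upTo (suc n))

  gD : (ℕ → Carrier) → Poly → Poly
  gD a p = sumP (zipWith (λ i k → scale k (aPoly a i)) (upTo (length p)) p)

  ⟨gD∣_⟩ : (ℕ → Carrier) → Poly → Carrier
  ⟨gD∣_⟩ a p = sumK (zipWith (λ i k → k * a i) (upTo (length p)) p)

  -- coefficient n (times n!) of the EGF product (Σ a_k t^k/k!)(Σ c_k t^k/k!)
  egfProd : (ℕ → Carrier) → (ℕ → Carrier) → ℕ → Carrier
  egfProd a cf n = sumK (map (λ j → ι (n C j) * (a (n ∸ j) * cf j)) (upTo (suc n)))

  -- EGF coefficients of the series t : n! [t^n] t = δ_{n,1}
  tEGF : ℕ → Carrier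
  tEGF n = if n ≡ᵇ 1 then 1# else 0#

  CharZero : Set ℓ
  CharZero = ∀ n → ¬ (ι (suc n) ≈ 0#)

-- Rooted trees: a root together with the (unordered) family of subtrees
-- hanging from it, represented by a list; isomorphism ignores the order.

data Tree : Set where
  node : List Tree → Tree

• : Tree
• = node []

⟨_∣•⟩ : List Tree → Tree
⟨ ts ∣•⟩ = node ts

mutual
  size : Tree → ℕ
  size (node ts) = suc (sizeF ts)

  sizeF : List Tree → ℕ
  sizeF []       = 0
  sizeF (t ∷ ts) = size t N.+ sizeF ts

-- all orderings of a list (n! of them, counted by position)
insertions : {A : Set} → A → List A → List (List A)
insertions x []       = (x ∷ []) ∷ []
insertions x (y ∷ ys) = (x ∷ y ∷ ys) ∷ map (y ∷_) (insertions x ys)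

perms : {A : Set} → List A → List (List A)
perms []       = [] ∷ []
perms (x ∷ xs) = concatMap (insertions x) (perms xs)

-- number of root-preserving isomorphisms T → U: a root-preserving
-- isomorphism node ts → node us is a bijection σ between the children
-- together with isomorphisms tᵢ → u_{σ(i)}.
mutual
  isoCount : Tree → Tree → ℕ
  isoCount (node ts) (node us) = sumN (map (isoF ts) (perms us))

  isoF : List Tree → List Tree → ℕ
  isoF []       []       = 1
  isoF []       (_ ∷ _)  = 0
  isoF (_ ∷ _)  []       = 0
  isoF (t ∷ ts) (u ∷ us) = isoCount t u N.* isoF ts us

  sumN : List ℕ → ℕ
  sumN []       = 0
  sumN (n ∷ ns) = n N.+ sumN ns

autCount : Tree → ℕ
autCount T = isoCount T T

_≅ᵇ_ : Tree → Tree → Bool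
T ≅ᵇ U = not (isoCount T U ≡ᵇ 0)

_≅_ : Tree → Tree → Set
T ≅ U = ¬ (isoCount T U ≡ 0)

-- all (planar representatives of) rooted trees with n vertices; fuel first
mutual
  treesF : ℕ → ℕ → List Tree
  treesF zero    _       = []
  treesF (suc f) zero    = []
  treesF (suc f) (suc n) = map node (forestsF f n)

  forestsF : ℕ → ℕ → List (List Tree)
  forestsF f       zero    = [] ∷ []
  forestsF zero    (suc m) = []
  forestsF (suc f) (suc m) =
    concatMap (λ k → concatMap (λ t → map (t ∷_) (forestsF f (m ∸ k)))
                               (treesF (suc f) (suc k)))
              (upTo (suc m))

trees : ℕ → List Tree
trees n = treesF n n

classes : ℕ → List Tree
classes n = deduplicateᵇ _≅ᵇ_ (trees n)

-- graftAll T T' = the list of T ↘_v T', one entry per vertex v of T'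
mutual
  graftAll : Tree → Tree → List Tree
  graftAll T (node us) = node (us ++ (T ∷ [])) ∷ map node (graftAllF T us)

  graftAllF : Tree → List Tree → List (List Tree)
  graftAllF T []       = []
  graftAllF T (u ∷ us) = map (_∷ us) (graftAll T u) ++ map (u ∷_) (graftAllF T us)

countᵇ : {A : Set} → (A → Bool) → List A → ℕ
countᵇ p []       = 0
countᵇ p (x ∷ xs) = if p x then suc (countᵇ p xs) else countᵇ p xs

-- coefficient of (the class of) S in T ↷ T' = #{v ∈ V(T') | T ↘_v T' ≅ S}
graftCoeff : Tree → Tree → Tree → ℕ
graftCoeff T T' S = countᵇ (_≅ᵇ S) (graftAll T T')

-- Elements of 𝒯[t] as functions from trees to K[t] (constant on
-- isomorphism classes), and the relations of the theorem.

module TreeSeries {c ℓ : Level} (F : Field c ℓ) where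
  open Field F
  open FieldOps F

  ClassFunction : (Tree → Poly) → Set ℓ
  ClassFunction X = ∀ T U → T ≅ U → X T ≈ₚ X U

  -- coefficient at S of  A ↷ B  for A ∈ 𝒯 (constant coefficients), B ∈ 𝒯[t]:
  -- Σ over classes [T], [T'] of A(T) B(T') · #{v | T ↘_v T' ≅ S}
  graftSeries : (Tree → Carrier) → (Tree → Poly) → Tree → Poly
  graftSeries A B S =
    sumP (concatMap (λ k → concatMap (λ l →
            concatMap (λ T → map (λ T' → scale (A T * ι (graftCoeff T T' S)) (B T'))
                                 (classes l))
                      (classes k))
          (upTo (suc (size S)))) (upTo (suc (size S))))

  SolvesODE : (ℕ → Carrier) → (Tree → Poly) → Set ℓ
  SolvesODE a P = ∀ S → deriv (P S) ≈ₚ graftSeries (λ T → ⟨gD∣ a ⟩ (P T)) P S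

  InitialBullet : (Tree → Poly) → Set ℓ
  InitialBullet P = ∀ S → eval (P S) 0# ≈ (if S ≅ᵇ • then 1# else 0#)

  normalise : (Tree → Poly) → Tree → Poly
  normalise P T = scale (ι (autCount T)) (P T)

  RelationI : (Tree → Poly) → Set ℓ
  RelationI p = ∀ (T₁ : Tree) (ts : List Tree) →
    p ⟨ T₁ ∷ ts ∣•⟩ ≈ₚ prodP (map (λ T → p ⟨ T ∷ [] ∣•⟩) (T₁ ∷ ts))

  RelationII : (ℕ → Carrier) → (Tree → Poly) → Set ℓ
  RelationII a p = ∀ T → p ⟨ T ∷ [] ∣•⟩ ≈ₚ integ (gD a (p T))

-- Write p = |Aut|·P. Grafting and cutting are adjoint: |Aut X| times the number of
-- vertices v with T ↘_v T′ ≅ X equals the number of ways of cutting one edge of X into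
-- copies of T (the part above the edge) and T′. Summing over isomorphism classes, the
-- equation P′ = ⟨g(D)|P⟩ ↷ P becomes the cut equation
--   p(X)′ = ∑_{X = A ↘ B} ⟨g(D)|p(A)⟩ · p(B),
-- which, with p(X)(0) = [X = •], determines p by induction on the size of X.
-- The family defined by p(•) = 1, (I) and (II) satisfies the same cut equation: by the
-- Leibniz rule for the product in (I), it reduces to p({T|•})′ = g(D) p(T), and g(D) q
-- has derivative g(D) q′ (the a_n(t) form an Appell sequence) and constant term ⟨g(D)|q⟩.
-- Hence the two families agree.

module Submission where

open import Defs
open import Level using (Level)
open import Algebra.Bundles using (CommutativeSemiring)
open import Data.Nat as ℕ using (ℕ; zero; suc; _∸_; _<_; _≤_; z≤n; s≤s)
import Data.Nat.Properties as ℕ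
open import Data.Nat.Combinatorics using (_C_)
open import Data.Nat.Combinatorics.Specification using (k>n⇒nCk≡0)
open import Data.Bool using (true; false; if_then_else_) renaming (T to IsTrue)
open import Data.List using (List; []; _∷_; _++_; map; concatMap; foldr; filter; zipWith; length; applyUpTo; upTo; deduplicateᵇ)
open import Data.List.Relation.Unary.All as All using (All; []; _∷_)
import Data.List.Relation.Unary.All.Properties as All
open import Data.List.Relation.Unary.Any as Any using (Any; here; there)
open import Data.List.Relation.Binary.Permutation.Propositional as ↭ using (_↭_)
open import Data.Product using (_×_; _,_; uncurry)
open import Data.Empty using (⊥-elim)
open import Function using (_∘_; case_of_)
open import Relation.Nullary using (¬_; yes; no)
open import Relation.Nullary.Decidable using (decidable-stable)
open import Relation.Unary using (Decidable)
open import Relation.Binary.PropositionalEquality as ≡ using (_≡_)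

select : ∀ {a} {A : Set a} → List A → List (A × List A)
select []       = []
select (x ∷ xs) = (x , xs) ∷ map (λ { (y , r) → y , x ∷ r }) (select xs)

module ListSum {c ℓ : Level} (R : CommutativeSemiring c ℓ) where
  open CommutativeSemiring R
  open import Relation.Binary.Reasoning.Setoid setoid
  open import Algebra.Properties.CommutativeSemigroup +-commutativeSemigroup
    using () renaming (interchange to +-interchange; x∙yz≈y∙xz to +-leftComm)

  private variable
    a b e : Level
    A : Set a
    B : Set b
    C : Set e

  ∑ : List A → (A → Carrier) → Carrier
  ∑ xs f = foldr _+_ 0# (map f xs)

  ∑-++ : ∀ (xs ys : List A) f → ∑ (xs ++ ys) f ≈ ∑ xs f + ∑ ys f
  ∑-++ []       ys f = sym (+-identityˡ _)
  ∑-++ (x ∷ xs) ys f = trans (+-congˡ (∑-++ xs ys f)) (sym (+-assoc _ _ _))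

  ∑-map : ∀ (g : A → B) xs f → ∑ (map g xs) f ≡ ∑ xs (f ∘ g)
  ∑-map g []       f = ≡.refl
  ∑-map g (x ∷ xs) f = ≡.cong (f (g x) +_) (∑-map g xs f)

  ∑-concatMap : ∀ (g : A → List B) xs f → ∑ (concatMap g xs) f ≈ ∑ xs (λ x → ∑ (g x) f)
  ∑-concatMap g []       f = refl
  ∑-concatMap g (x ∷ xs) f = trans (∑-++ (g x) _ f) (+-congˡ (∑-concatMap g xs f))

  ∑-congᴬ : ∀ {xs : List A} {f g} → All (λ x → f x ≈ g x) xs → ∑ xs f ≈ ∑ xs g
  ∑-congᴬ []       = refl
  ∑-congᴬ (e ∷ es) = +-cong e (∑-congᴬ es)

  ∑-cong : ∀ (xs : List A) {f g} → (∀ x → f x ≈ g x) → ∑ xs f ≈ ∑ xs g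
  ∑-cong xs e = ∑-congᴬ (All.universal e xs)

  ∑-zeroᴬ : ∀ {xs : List A} {f} → All (λ x → f x ≈ 0#) xs → ∑ xs f ≈ 0#
  ∑-zeroᴬ []       = refl
  ∑-zeroᴬ (e ∷ es) = trans (+-cong e (∑-zeroᴬ es)) (+-identityˡ 0#)

  ∑-zero : ∀ (xs : List A) {f} → (∀ x → f x ≈ 0#) → ∑ xs f ≈ 0#
  ∑-zero xs e = ∑-zeroᴬ (All.universal e xs)

  ∑-distrib-+ : ∀ (xs : List A) f g → ∑ xs (λ x → f x + g x) ≈ ∑ xs f + ∑ xs g
  ∑-distrib-+ []       f g = sym (+-identityˡ _)
  ∑-distrib-+ (x ∷ xs) f g = trans (+-congˡ (∑-distrib-+ xs f g)) (+-interchange _ _ _ _)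

  *-distribˡ-∑ : ∀ k (xs : List A) f → k * ∑ xs f ≈ ∑ xs (λ x → k * f x)
  *-distribˡ-∑ k []       f = zeroʳ k
  *-distribˡ-∑ k (x ∷ xs) f = trans (distribˡ k _ _) (+-congˡ (*-distribˡ-∑ k xs f))

  *-distribʳ-∑ : ∀ k (xs : List A) f → ∑ xs f * k ≈ ∑ xs (λ x → f x * k)
  *-distribʳ-∑ k xs f = trans (*-comm _ k) (trans (*-distribˡ-∑ k xs f) (∑-cong xs (λ x → *-comm k (f x))))

  ∑-comm : ∀ (xs : List A) (ys : List B) (f : A → B → Carrier) → ∑ xs (λ x → ∑ ys (f x)) ≈ ∑ ys (λ y → ∑ xs (λ x → f x y))
  ∑-comm []       ys f = sym (∑-zero ys (λ _ → refl))
  ∑-comm (x ∷ xs) ys f = trans (+-congˡ (∑-comm xs ys f)) (sym (∑-distrib-+ ys (f x) (λ y → ∑ xs (λ x → f x y))))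

  ∑-product : ∀ (xs : List A) (ys : List B) (es : List C) (f : A → C → Carrier) (g : B → C → Carrier) →
    ∑ xs (λ x → ∑ ys (λ y → ∑ es (λ e → f x e * g y e))) ≈ ∑ es (λ e → ∑ xs (λ x → f x e) * ∑ ys (λ y → g y e))
  ∑-product xs ys es f g = begin
    ∑ xs (λ x → ∑ ys (λ y → ∑ es (λ e → f x e * g y e)))
      ≈⟨ ∑-cong xs (λ x → trans (∑-comm ys es (λ y e → f x e * g y e))
                                 (∑-cong es (λ e → sym (*-distribˡ-∑ (f x e) ys (λ y → g y e))))) ⟩
    ∑ xs (λ x → ∑ es (λ e → f x e * ∑ ys (λ y → g y e)))
      ≈⟨ ∑-comm xs es (λ x e → f x e * ∑ ys (λ y → g y e)) ⟩
    ∑ es (λ e → ∑ xs (λ x → f x e * ∑ ys (λ y → g y e)))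
      ≈⟨ ∑-cong es (λ e → sym (*-distribʳ-∑ (∑ ys (λ y → g y e)) xs (λ x → f x e))) ⟩
    ∑ es (λ e → ∑ xs (λ x → f x e) * ∑ ys (λ y → g y e)) ∎

  ∑-applyUpTo-single : ∀ (v : ℕ → Carrier) g n {j} → j < n →
    (∀ {i} → i < n → ¬ i ≡ j → v (g i) ≈ 0#) → ∑ (applyUpTo g n) v ≈ v (g j)
  ∑-applyUpTo-single v g (suc n) {zero} _ off =
    trans (+-congˡ (∑-zeroᴬ (All.applyUpTo⁺₁ (g ∘ suc) n (λ i<n → off (s≤s i<n) λ ())))) (+-identityʳ _)
  ∑-applyUpTo-single v g (suc n) {suc j} (s≤s j<n) off =
    trans (+-congʳ (off (s≤s z≤n) λ ())) (trans (+-identityˡ _)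
      (∑-applyUpTo-single v (g ∘ suc) n j<n (λ i<n i≢j → off (s≤s i<n) (i≢j ∘ ℕ.suc-injective))))

  ∑-filter : ∀ {p} {P : A → Set p} (P? : Decidable P) xs f → (∀ x → ¬ P x → f x ≈ 0#) → ∑ (filter P? xs) f ≈ ∑ xs f
  ∑-filter P? []       f f≈0 = refl
  ∑-filter P? (x ∷ xs) f f≈0 with P? x
  ... | yes _  = +-congˡ (∑-filter P? xs f f≈0)
  ... | no ¬Px = trans (∑-filter P? xs f f≈0) (sym (trans (+-congʳ (f≈0 x ¬Px)) (+-identityˡ _)))

  ∑ˢ : List A → (A → List A → Carrier) → Carrier
  ∑ˢ xs F = ∑ (select xs) (uncurry F)

  ∑ˢ-∷ : ∀ x (xs : List A) F → ∑ˢ (x ∷ xs) F ≈ F x xs + ∑ˢ xs (λ y r → F y (x ∷ r))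
  ∑ˢ-∷ x xs F = +-congˡ (reflexive (∑-map _ (select xs) (uncurry F)))

  ∑ˢ-cong : ∀ (xs : List A) {F G} → (∀ x r → F x r ≈ G x r) → ∑ˢ xs F ≈ ∑ˢ xs G
  ∑ˢ-cong xs e = ∑-cong (select xs) (uncurry e)

  ∑ˢ-↭ : ∀ {xs ys : List A} → xs ↭ ys → ∀ F → (∀ x {r r′} → r ↭ r′ → F x r ≈ F x r′) → ∑ˢ xs F ≈ ∑ˢ ys F
  ∑ˢ-↭ ↭.refl F inv = refl
  ∑ˢ-↭ {xs = x ∷ xs} {ys = x ∷ ys} (↭.prep x p) F inv = begin
    ∑ˢ (x ∷ xs) F                            ≈⟨ ∑ˢ-∷ x xs F ⟩
    F x xs + ∑ˢ xs (λ y r → F y (x ∷ r))     ≈⟨ +-cong (inv x p) (∑ˢ-↭ p _ (λ y q → inv y (↭.prep x q))) ⟩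
    F x ys + ∑ˢ ys (λ y r → F y (x ∷ r))     ≈⟨ sym (∑ˢ-∷ x ys F) ⟩
    ∑ˢ (x ∷ ys) F                            ∎
  ∑ˢ-↭ {xs = x ∷ y ∷ xs} {ys = y ∷ x ∷ ys} (↭.swap x y p) F inv = begin
    ∑ˢ (x ∷ y ∷ xs) F
      ≈⟨ trans (∑ˢ-∷ x (y ∷ xs) F) (+-congˡ (∑ˢ-∷ y xs _)) ⟩
    F x (y ∷ xs) + (F y (x ∷ xs) + ∑ˢ xs (λ z r → F z (x ∷ y ∷ r)))
      ≈⟨ +-cong (inv x (↭.prep y p)) (+-cong (inv y (↭.prep x p))
           (trans (∑ˢ-↭ p _ (λ z q → inv z (↭.prep x (↭.prep y q)))) (∑ˢ-cong ys (λ z r → inv z (↭.swap x y ↭.refl))))) ⟩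
    F x (y ∷ ys) + (F y (x ∷ ys) + ∑ˢ ys (λ z r → F z (y ∷ x ∷ r)))
      ≈⟨ +-leftComm _ _ _ ⟩
    F y (x ∷ ys) + (F x (y ∷ ys) + ∑ˢ ys (λ z r → F z (y ∷ x ∷ r)))
      ≈⟨ sym (trans (∑ˢ-∷ y (x ∷ ys) F) (+-congˡ (∑ˢ-∷ x ys _))) ⟩
    ∑ˢ (y ∷ x ∷ ys) F ∎
  ∑ˢ-↭ (↭.trans p q) F inv = trans (∑ˢ-↭ p F inv) (∑ˢ-↭ q F inv)

module Combinatorics where
  open import Data.Nat using (_+_; _*_)
  open import Data.Nat.Properties
  open import Data.Nat.Combinatorics using (nCk+nC[k+1]≡[n+1]C[k+1]; nC1≡n)
  open import Data.Nat.ListAction using (sum)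
  open import Data.Nat.ListAction.Properties using (sum-↭)
  import Data.List.Relation.Unary.Any.Properties as Any
  open import Data.List.Relation.Binary.Permutation.Propositional.Properties using (¬x∷xs↭[]; map⁺)
  open import Data.Bool.Properties using (T-≡)
  open import Data.Product using (∃₂)
  open import Data.Sum using (inj₁; inj₂)
  open import Function using (id)
  open import Function.Bundles using (Equivalence)
  open import Relation.Binary.PropositionalEquality
  open import Algebra.Properties.CommutativeSemigroup *-commutativeSemigroup
    using () renaming (x∙yz≈y∙xz to *-leftComm)
  open import Algebra.Properties.CommutativeSemigroup +-commutativeSemigroup
    using () renaming (x∙yz≈y∙xz to +-leftComm)
  open import Data.Nat.Solver using (module +-*-Solver)
  open ≡-Reasoning

  open ListSum +-*-commutativeSemiring

  [k+1]*[n+1]C[k+1]≡[n+1]*nCk : ∀ n k → suc k * (suc n C suc k) ≡ suc n * (n C k)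
  [k+1]*[n+1]C[k+1]≡[n+1]*nCk zero    zero    = refl
  [k+1]*[n+1]C[k+1]≡[n+1]*nCk zero    (suc k) =
    trans (cong (suc (suc k) *_) (k>n⇒nCk≡0 {1} {suc (suc k)} (s≤s (s≤s z≤n)))) (*-zeroʳ (suc (suc k)))
  [k+1]*[n+1]C[k+1]≡[n+1]*nCk (suc n) zero    =
    trans (+-identityʳ _) (trans (nC1≡n (suc (suc n))) (sym (*-identityʳ (suc (suc n)))))
  [k+1]*[n+1]C[k+1]≡[n+1]*nCk (suc n) (suc k) = begin
    suc (suc k) * (suc (suc n) C suc (suc k))
      ≡⟨ cong (suc (suc k) *_) (nCk+nC[k+1]≡[n+1]C[k+1] (suc n) (suc k)) ⟨
    suc (suc k) * (A + B)
      ≡⟨ *-distribˡ-+ (suc (suc k)) A B ⟩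
    (A + suc k * A) + suc (suc k) * B
      ≡⟨ cong₂ (λ u v → (A + u) + v) ([k+1]*[n+1]C[k+1]≡[n+1]*nCk n k) ([k+1]*[n+1]C[k+1]≡[n+1]*nCk n (suc k)) ⟩
    (A + suc n * (n C k)) + suc n * (n C suc k)
      ≡⟨ +-assoc A _ _ ⟩
    A + (suc n * (n C k) + suc n * (n C suc k))
      ≡⟨ cong (A +_) (*-distribˡ-+ (suc n) (n C k) (n C suc k)) ⟨
    A + suc n * (n C k + n C suc k)
      ≡⟨ cong (λ z → A + suc n * z) (nCk+nC[k+1]≡[n+1]C[k+1] n k) ⟩
    suc (suc n) * A ∎
    where
    A = suc n C suc k
    B = suc n C suc (suc k)

  isoCountF : List Tree → List Tree → ℕ
  isoCountF ts us = isoCount (node ts) (node us)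

  sumN≡sum : ∀ ns → sumN ns ≡ sum ns
  sumN≡sum []       = refl
  sumN≡sum (n ∷ ns) = cong (n +_) (sumN≡sum ns)

  isoCountF-perms : ∀ ts us → isoCountF ts us ≡ ∑ (perms us) (isoF ts)
  isoCountF-perms ts us = sumN≡sum (map (isoF ts) (perms us))

  ∑-insertions-isoF : ∀ u σ ts →
    ∑ (insertions u σ) (isoF ts) ≡ ∑ˢ ts (λ t r → isoCount t u * isoF r σ)
  ∑-insertions-isoF u []       []       = refl
  ∑-insertions-isoF u []       (t ∷ ts) = cong (isoCount t u * isoF ts [] +_)
    (sym (trans (∑-map _ (select ts) _) (∑-zero (select ts) (λ (t′ , _) → *-zeroʳ (isoCount t′ u)))))
  ∑-insertions-isoF u (y ∷ ys) []       = trans (∑-map (y ∷_) (insertions u ys) (isoF [])) (∑-zero (insertions u ys) (λ _ → refl))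
  ∑-insertions-isoF u (y ∷ ys) (t ∷ ts) = cong (isoCount t u * isoF ts (y ∷ ys) +_) (begin
    ∑ (map (y ∷_) (insertions u ys)) (isoF (t ∷ ts))              ≡⟨ ∑-map (y ∷_) (insertions u ys) _ ⟩
    ∑ (insertions u ys) (λ σ → isoCount t y * isoF ts σ)           ≡⟨ sym (*-distribˡ-∑ (isoCount t y) (insertions u ys) (isoF ts)) ⟩
    isoCount t y * ∑ (insertions u ys) (isoF ts)                    ≡⟨ cong (isoCount t y *_) (∑-insertions-isoF u ys ts) ⟩
    isoCount t y * ∑ˢ ts (λ t′ r → isoCount t′ u * isoF r ys)
      ≡⟨ *-distribˡ-∑ (isoCount t y) (select ts) (λ (t′ , r) → isoCount t′ u * isoF r ys) ⟩
    ∑ˢ ts (λ t′ r → isoCount t y * (isoCount t′ u * isoF r ys))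
      ≡⟨ ∑ˢ-cong ts (λ t′ r → *-leftComm (isoCount t y) (isoCount t′ u) (isoF r ys)) ⟩
    ∑ˢ ts (λ t′ r → isoCount t′ u * isoF (t ∷ r) (y ∷ ys))          ≡⟨ sym (∑-map _ (select ts) _) ⟩
    ∑ (map (λ { (t′ , r) → t′ , t ∷ r }) (select ts)) _             ∎)

  -- An isomorphism onto node (u ∷ us) sends some child t to u and the other children onto us.
  isoCountF-∷ʳ : ∀ ts u us → isoCountF ts (u ∷ us) ≡ ∑ˢ ts (λ t r → isoCount t u * isoCountF r us)
  isoCountF-∷ʳ ts u us = begin
    isoCountF ts (u ∷ us)
      ≡⟨ isoCountF-perms ts (u ∷ us) ⟩
    ∑ (concatMap (insertions u) (perms us)) (isoF ts)
      ≡⟨ ∑-concatMap (insertions u) (perms us) (isoF ts) ⟩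
    ∑ (perms us) (λ σ → ∑ (insertions u σ) (isoF ts))
      ≡⟨ ∑-cong (perms us) (λ σ → ∑-insertions-isoF u σ ts) ⟩
    ∑ (perms us) (λ σ → ∑ˢ ts (λ t r → isoCount t u * isoF r σ))
      ≡⟨ ∑-comm (perms us) (select ts) _ ⟩
    ∑ˢ ts (λ t r → ∑ (perms us) (λ σ → isoCount t u * isoF r σ))
      ≡⟨ ∑ˢ-cong ts (λ t r → trans (sym (*-distribˡ-∑ (isoCount t u) (perms us) (isoF r)))
                                   (cong (isoCount t u *_) (sym (isoCountF-perms r us)))) ⟩
    ∑ˢ ts (λ t r → isoCount t u * isoCountF r us) ∎

  isoCountF-[]-∷ : ∀ u us → isoCountF [] (u ∷ us) ≡ 0
  isoCountF-[]-∷ u us = isoCountF-∷ʳ [] u us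

  isoCountF-∷ˡ : ∀ t ts us → isoCountF (t ∷ ts) us ≡ ∑ˢ us (λ u r → isoCount t u * isoCountF ts r)
  isoCountF-∷ˡ t ts []       = refl
  isoCountF-∷ˡ t ts (u ∷ us) = begin
    isoCountF (t ∷ ts) (u ∷ us)
      ≡⟨ trans (isoCountF-∷ʳ (t ∷ ts) u us) (∑ˢ-∷ t ts _) ⟩
    isoCount t u * isoCountF ts us + ∑ˢ ts (λ t′ r → isoCount t′ u * isoCountF (t ∷ r) us)
      ≡⟨ cong (isoCount t u * isoCountF ts us +_) matchBoth ⟩
    isoCount t u * isoCountF ts us + ∑ˢ us (λ u′ r′ → isoCount t u′ * isoCountF ts (u ∷ r′))
      ≡⟨ ∑ˢ-∷ u us _ ⟨
    ∑ˢ (u ∷ us) (λ u′ r → isoCount t u′ * isoCountF ts r) ∎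
    where
    term : Tree → List Tree → Tree → List Tree → ℕ
    term t′ r u′ r′ = isoCount t′ u * (isoCount t u′ * isoCountF r r′)
    matchBoth : ∑ˢ ts (λ t′ r → isoCount t′ u * isoCountF (t ∷ r) us) ≡ ∑ˢ us (λ u′ r′ → isoCount t u′ * isoCountF ts (u ∷ r′))
    matchBoth = begin
      ∑ˢ ts (λ t′ r → isoCount t′ u * isoCountF (t ∷ r) us)
        ≡⟨ ∑ˢ-cong ts (λ t′ r → trans (cong (isoCount t′ u *_) (isoCountF-∷ˡ t r us))
                                      (*-distribˡ-∑ (isoCount t′ u) (select us) (λ (u′ , r′) → isoCount t u′ * isoCountF r r′))) ⟩
      ∑ˢ ts (λ t′ r → ∑ˢ us (term t′ r))
        ≡⟨ ∑-comm (select ts) (select us) (λ (t′ , r) (u′ , r′) → term t′ r u′ r′) ⟩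
      ∑ˢ us (λ u′ r′ → ∑ˢ ts (λ t′ r → term t′ r u′ r′))
        ≡⟨ ∑ˢ-cong us (λ u′ r′ → trans (∑ˢ-cong ts (λ t′ r → *-leftComm (isoCount t′ u) (isoCount t u′) (isoCountF r r′)))
                                        (sym (*-distribˡ-∑ (isoCount t u′) (select ts) (λ (t′ , r) → isoCount t′ u * isoCountF r r′)))) ⟩
      ∑ˢ us (λ u′ r′ → isoCount t u′ * ∑ˢ ts (λ t′ r → isoCount t′ u * isoCountF r r′))
        ≡⟨ ∑ˢ-cong us (λ u′ r′ → cong (isoCount t u′ *_) (isoCountF-∷ʳ ts u r′)) ⟨
      ∑ˢ us (λ u′ r′ → isoCount t u′ * isoCountF ts (u ∷ r′)) ∎

  isoCountF-↭ˡ : ∀ us {ts ts′} → ts ↭ ts′ → isoCountF ts us ≡ isoCountF ts′ us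
  isoCountF-↭ˡ [] {[]}    {[]}    p = refl
  isoCountF-↭ˡ [] {[]}    {_ ∷ _} p = ⊥-elim (¬x∷xs↭[] (↭.↭-sym p))
  isoCountF-↭ˡ [] {_ ∷ _} {[]}    p = ⊥-elim (¬x∷xs↭[] p)
  isoCountF-↭ˡ [] {_ ∷ _} {_ ∷ _} p = refl
  isoCountF-↭ˡ (u ∷ us) {ts} {ts′} p = begin
    isoCountF ts (u ∷ us)                         ≡⟨ isoCountF-∷ʳ ts u us ⟩
    ∑ˢ ts (λ t r → isoCount t u * isoCountF r us)  ≡⟨ ∑ˢ-↭ p _ (λ t q → cong (isoCount t u *_) (isoCountF-↭ˡ us q)) ⟩
    ∑ˢ ts′ (λ t r → isoCount t u * isoCountF r us) ≡⟨ isoCountF-∷ʳ ts′ u us ⟨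
    isoCountF ts′ (u ∷ us)                        ∎

  isoCountF-↭ʳ : ∀ ts {us us′} → us ↭ us′ → isoCountF ts us ≡ isoCountF ts us′
  isoCountF-↭ʳ [] {[]}    {[]}    p = refl
  isoCountF-↭ʳ [] {[]}    {_ ∷ _} p = ⊥-elim (¬x∷xs↭[] (↭.↭-sym p))
  isoCountF-↭ʳ [] {_ ∷ _} {[]}    p = ⊥-elim (¬x∷xs↭[] p)
  isoCountF-↭ʳ [] {u ∷ us} {u′ ∷ us′} p = trans (isoCountF-[]-∷ u us) (sym (isoCountF-[]-∷ u′ us′))
  isoCountF-↭ʳ (t ∷ ts) {us} {us′} p = begin
    isoCountF (t ∷ ts) us                          ≡⟨ isoCountF-∷ˡ t ts us ⟩
    ∑ˢ us (λ u r → isoCount t u * isoCountF ts r)   ≡⟨ ∑ˢ-↭ p _ (λ u q → cong (isoCount t u *_) (isoCountF-↭ʳ ts q)) ⟩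
    ∑ˢ us′ (λ u r → isoCount t u * isoCountF ts r)  ≡⟨ isoCountF-∷ˡ t ts us′ ⟨
    isoCountF (t ∷ ts) us′                         ∎

  ∑ˢ-nonzero : ∀ {A : Set} (xs : List A) F → ¬ ∑ˢ xs F ≡ 0 → ∃₂ λ x r → x ∷ r ↭ xs × ¬ F x r ≡ 0
  ∑ˢ-nonzero []       F ≢0 = ⊥-elim (≢0 refl)
  ∑ˢ-nonzero (x ∷ xs) F ≢0 with F x xs ≟ 0
  ... | no Fxxs≢0 = x , xs , ↭.refl , Fxxs≢0
  ... | yes Fxxs≡0 with ∑ˢ-nonzero xs (λ y r → F y (x ∷ r)) (λ e → ≢0 (trans (∑ˢ-∷ x xs F) (cong₂ _+_ Fxxs≡0 e)))
  ...   | y , r , y∷r↭xs , Fyr≢0 = y , x ∷ r , ↭.trans (↭.swap y x ↭.refl) (↭.prep x y∷r↭xs) , Fyr≢0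

  ≢0-*ˡ : ∀ m n → ¬ m * n ≡ 0 → ¬ m ≡ 0
  ≢0-*ˡ m n mn≢0 m≡0 = mn≢0 (cong (_* n) m≡0)

  ≢0-*ʳ : ∀ m n → ¬ m * n ≡ 0 → ¬ n ≡ 0
  ≢0-*ʳ m n mn≢0 n≡0 = mn≢0 (trans (cong (m *_) n≡0) (*-zeroʳ m))

  ∷-≅⇒matching : ∀ a as bs → node (a ∷ as) ≅ node bs → ∃₂ λ b r → b ∷ r ↭ bs × a ≅ b × node as ≅ node r
  ∷-≅⇒matching a as bs a∷as≅bs with ∑ˢ-nonzero bs (λ x r → isoCount a x * isoCountF as r) (a∷as≅bs ∘ trans (isoCountF-∷ˡ a as bs))
  ... | b , r , b∷r↭bs , nz = b , r , b∷r↭bs , ≢0-*ˡ _ _ nz , ≢0-*ʳ (isoCount a b) _ nz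

  mutual
    ≅⇒isoCount≡ : ∀ A B Z → A ≅ B → isoCount A Z ≡ isoCount B Z
    ≅⇒isoCount≡ (node as) (node bs) (node zs) A≅B = ≅⇒isoCountF≡ as bs zs A≅B

    ≅⇒isoCountF≡ : ∀ as bs zs → node as ≅ node bs → isoCountF as zs ≡ isoCountF bs zs
    ≅⇒isoCountF≡ []       []       zs _ = refl
    ≅⇒isoCountF≡ []       (b ∷ bs) zs ≢0 = ⊥-elim (≢0 (isoCountF-[]-∷ b bs))
    ≅⇒isoCountF≡ (a ∷ as) bs       zs a∷as≅bs with ∷-≅⇒matching a as bs a∷as≅bs
    ... | b , r , b∷r↭bs , a≅b , as≅r = begin
      isoCountF (a ∷ as) zs                           ≡⟨ isoCountF-∷ˡ a as zs ⟩
      ∑ˢ zs (λ z r′ → isoCount a z * isoCountF as r′)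
        ≡⟨ ∑ˢ-cong zs (λ z r′ → cong₂ _*_ (≅⇒isoCount≡ a b z a≅b) (≅⇒isoCountF≡ as r r′ as≅r)) ⟩
      ∑ˢ zs (λ z r′ → isoCount b z * isoCountF r r′)   ≡⟨ isoCountF-∷ˡ b r zs ⟨
      isoCountF (b ∷ r) zs                            ≡⟨ isoCountF-↭ˡ zs b∷r↭bs ⟩
      isoCountF bs zs                                 ∎

  mutual
    ≅-refl : ∀ T → T ≅ T
    ≅-refl (node ts) = ≅F-refl ts

    ≅F-refl : ∀ ts → node ts ≅ node ts
    ≅F-refl []       ()
    ≅F-refl (t ∷ ts) ≡0
      with m*n≡0⇒m≡0∨n≡0 (isoCount t t) (m+n≡0⇒m≡0 _ (trans (sym (trans (isoCountF-∷ˡ t ts (t ∷ ts)) (∑ˢ-∷ t ts _))) ≡0))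
    ... | inj₁ tt≡0 = ≅-refl t tt≡0
    ... | inj₂ tsts≡0 = ≅F-refl ts tsts≡0

  ≅-sym : ∀ A B → A ≅ B → B ≅ A
  ≅-sym A B A≅B BA≡0 = ≅-refl A (trans (≅⇒isoCount≡ A B A A≅B) BA≡0)

  ≅-trans : ∀ A B D → A ≅ B → B ≅ D → A ≅ D
  ≅-trans A B D A≅B B≅D AD≡0 = B≅D (trans (sym (≅⇒isoCount≡ A B D A≅B)) AD≡0)

  sizeF≡sum : ∀ ts → sizeF ts ≡ sum (map size ts)
  sizeF≡sum []       = refl
  sizeF≡sum (t ∷ ts) = cong (size t +_) (sizeF≡sum ts)

  mutual
    ≅⇒size≡ : ∀ A B → A ≅ B → size A ≡ size B
    ≅⇒size≡ (node as) (node bs) ≢0 = cong suc (≅⇒sizeF≡ as bs ≢0)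

    ≅⇒sizeF≡ : ∀ as bs → node as ≅ node bs → sizeF as ≡ sizeF bs
    ≅⇒sizeF≡ []       []       _ = refl
    ≅⇒sizeF≡ []       (b ∷ bs) ≢0 = ⊥-elim (≢0 (isoCountF-[]-∷ b bs))
    ≅⇒sizeF≡ (a ∷ as) bs       a∷as≅bs with ∷-≅⇒matching a as bs a∷as≅bs
    ... | b , r , b∷r↭bs , a≅b , as≅r = begin
      size a + sizeF as       ≡⟨ cong₂ _+_ (≅⇒size≡ a b a≅b) (≅⇒sizeF≡ as r as≅r) ⟩
      sizeF (b ∷ r)           ≡⟨ sizeF≡sum (b ∷ r) ⟩
      sum (map size (b ∷ r))  ≡⟨ sum-↭ (map⁺ size b∷r↭bs) ⟩
      sum (map size bs)       ≡⟨ sizeF≡sum bs ⟨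
      sizeF bs            ∎

  mutual
    cutsF : List Tree → List (Tree × List Tree)
    cutsF []       = []
    cutsF (s ∷ ss) = (s , ss) ∷ (map (λ (x , r) → x , r ∷ ss) (cuts s) ++ map (λ (x , r) → x , s ∷ r) (cutsF ss))

    cuts : Tree → List (Tree × Tree)
    cuts (node ss) = map (λ (x , r) → x , node r) (cutsF ss)

  ∑-cutsF-∷ : ∀ s ss (g : Tree × List Tree → ℕ) → ∑ (cutsF (s ∷ ss)) g ≡
    g (s , ss) + (∑ (cuts s) (λ (x , r) → g (x , r ∷ ss)) + ∑ (cutsF ss) (λ (x , r) → g (x , s ∷ r)))
  ∑-cutsF-∷ s ss g = cong (g (s , ss) +_) (trans (∑-++ (map _ (cuts s)) (map _ (cutsF ss)) g)
    (cong₂ _+_ (∑-map _ (cuts s) g) (∑-map _ (cutsF ss) g)))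

  -- Both sides count triples (cut vertex v, top-level tree z, remaining forest):
  -- either v lies in the selected tree z, or in the rest of the forest.
  ∑-cutsF-∑ˢ : ∀ ss (h : Tree → Tree → List Tree → ℕ) →
    ∑ (cutsF ss) (λ (x , r) → ∑ˢ r (h x)) ≡
    ∑ˢ ss (λ z r → ∑ (cuts z) (λ (x , y) → h x y r) + ∑ (cutsF r) (λ (x , r′) → h x z r′))
  ∑-cutsF-∑ˢ []       h = refl
  ∑-cutsF-∑ˢ (s ∷ ss) h = begin
    ∑ (cutsF (s ∷ ss)) (λ (x , r) → ∑ˢ r (h x))      ≡⟨ lhs ⟩
    L + ((A₁ + A₂) + (A₃ + (B₁ + B₂)))               ≡⟨ solve 6 (λ l a₁ a₂ a₃ b₁ b₂ →
                                                          l :+ ((a₁ :+ a₂) :+ (a₃ :+ (b₁ :+ b₂))) :=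
                                                          (a₁ :+ a₃) :+ (b₁ :+ (l :+ (a₂ :+ b₂)))) refl L A₁ A₂ A₃ B₁ B₂ ⟩
    (A₁ + A₃) + (B₁ + (L + (A₂ + B₂)))               ≡⟨ rhs ⟨
    ∑ˢ (s ∷ ss) (λ z r → ∑ (cuts z) (λ (x , y) → h x y r) + ∑ (cutsF r) (λ (x , r′) → h x z r′)) ∎
    where
    open +-*-Solver
    L  = ∑ˢ ss (h s)
    A₁ = ∑ (cuts s) (λ (x , y) → h x y ss)
    A₂ = ∑ (cuts s) (λ (x , y) → ∑ˢ ss (λ z r → h x z (y ∷ r)))
    A₃ = ∑ (cutsF ss) (λ (x , r) → h x s r)
    B₁ = ∑ˢ ss (λ z r → ∑ (cuts z) (λ (x , y) → h x y (s ∷ r)))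
    B₂ = ∑ˢ ss (λ z r → ∑ (cutsF r) (λ (x , r′) → h x z (s ∷ r′)))
    lhs : ∑ (cutsF (s ∷ ss)) (λ (x , r) → ∑ˢ r (h x)) ≡ L + ((A₁ + A₂) + (A₃ + (B₁ + B₂)))
    lhs = trans (∑-cutsF-∷ s ss _) (cong (L +_) (cong₂ _+_
      (trans (∑-cong (cuts s) (λ (x , y) → ∑ˢ-∷ y ss (h x))) (∑-distrib-+ (cuts s) _ _))
      (trans (∑-cong (cutsF ss) (λ (x , r) → ∑ˢ-∷ s r (h x)))
             (trans (∑-distrib-+ (cutsF ss) _ _)
                    (cong (A₃ +_) (trans (∑-cutsF-∑ˢ ss (λ x z r → h x z (s ∷ r))) (∑-distrib-+ (select ss) _ _)))))))
    rhs : ∑ˢ (s ∷ ss) (λ z r → ∑ (cuts z) (λ (x , y) → h x y r) + ∑ (cutsF r) (λ (x , r′) → h x z r′))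
        ≡ (A₁ + A₃) + (B₁ + (L + (A₂ + B₂)))
    rhs = trans (∑ˢ-∷ s ss _) (cong ((A₁ + A₃) +_) (begin
      ∑ˢ ss (λ z r → ∑ (cuts z) (λ (x , y) → h x y (s ∷ r)) + ∑ (cutsF (s ∷ r)) (λ (x , r′) → h x z r′))
        ≡⟨ ∑ˢ-cong ss (λ z r → cong (∑ (cuts z) (λ (x , y) → h x y (s ∷ r)) +_) (∑-cutsF-∷ s r _)) ⟩
      ∑ˢ ss (λ z r → ∑ (cuts z) (λ (x , y) → h x y (s ∷ r)) +
                     (h s z r + (∑ (cuts s) (λ (x , y) → h x z (y ∷ r)) + ∑ (cutsF r) (λ (x , r′) → h x z (s ∷ r′)))))
        ≡⟨ trans (∑-distrib-+ (select ss) _ _) (cong (B₁ +_) (trans (∑-distrib-+ (select ss) _ _) (cong (L +_)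
             (trans (∑-distrib-+ (select ss) _ _) (cong (_+ B₂) (sym (∑-comm (cuts s) (select ss) _))))))) ⟩
      B₁ + (L + (A₂ + B₂)) ∎))

  ∑ˢ-isoCountF-[] : ∀ (k : Tree → ℕ) ss →
    ∑ˢ ss (λ x r → k x * isoCountF [] r) ≡ ∑ (cutsF ss) (λ (x , r) → k x * isoCountF [] r)
  ∑ˢ-isoCountF-[] k []       = refl
  ∑ˢ-isoCountF-[] k (s ∷ ss) = begin
    ∑ˢ (s ∷ ss) (λ x r → k x * isoCountF [] r)
      ≡⟨ ∑ˢ-∷ s ss _ ⟩
    k s * isoCountF [] ss + ∑ˢ ss (λ x r → k x * isoCountF [] (s ∷ r))
      ≡⟨ cong (k s * isoCountF [] ss +_) (trans (∑-zero (select ss) (λ (x , r) → k[x]*0 x s r))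
           (sym (cong₂ _+_ (∑-zero (cuts s) (λ (x , y) → k[x]*0 x y ss)) (∑-zero (cutsF ss) (λ (x , r) → k[x]*0 x s r))))) ⟩
    k s * isoCountF [] ss + (∑ (cuts s) (λ (x , y) → k x * isoCountF [] (y ∷ ss))
                            + ∑ (cutsF ss) (λ (x , r) → k x * isoCountF [] (s ∷ r)))
      ≡⟨ ∑-cutsF-∷ s ss _ ⟨
    ∑ (cutsF (s ∷ ss)) (λ (x , r) → k x * isoCountF [] r) ∎
    where
    k[x]*0 : ∀ x y r → k x * isoCountF [] (y ∷ r) ≡ 0
    k[x]*0 x y r = trans (cong (k x *_) (isoCountF-[]-∷ y r)) (*-zeroʳ (k x))

  -- Grafting T onto T′ and cutting an edge of X are adjoint operations.
  mutual
    ∑-graftAll-isoCount : ∀ T T′ X →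
      ∑ (graftAll T T′) (λ Y → isoCount Y X) ≡ ∑ (cuts X) (λ (A , B) → isoCount T A * isoCount T′ B)
    ∑-graftAll-isoCount T (node us) (node ss) = begin
      isoCountF (us ++ T ∷ []) ss + ∑ (map node (graftAllF T us)) (λ Y → isoCount Y (node ss))
        ≡⟨ cong (isoCountF (us ++ T ∷ []) ss +_) (∑-map node (graftAllF T us) _) ⟩
      isoCountF (us ++ T ∷ []) ss + ∑ (graftAllF T us) (λ ys → isoCountF ys ss)
        ≡⟨ ∑-graftAllF-isoCountF T us ss ⟩
      ∑ (cutsF ss) (λ (A , r) → isoCount T A * isoCountF us r)
        ≡⟨ ∑-map _ (cutsF ss) _ ⟨
      ∑ (cuts (node ss)) (λ (A , B) → isoCount T A * isoCount (node us) B) ∎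

    ∑-graftAllF-isoCountF : ∀ T us ss →
      isoCountF (us ++ T ∷ []) ss + ∑ (graftAllF T us) (λ ys → isoCountF ys ss) ≡
      ∑ (cutsF ss) (λ (A , r) → isoCount T A * isoCountF us r)
    ∑-graftAllF-isoCountF T [] ss = trans (+-identityʳ _) (trans (isoCountF-∷ˡ T [] ss) (∑ˢ-isoCountF-[] (isoCount T) ss))
    ∑-graftAllF-isoCountF T (u ∷ us) ss = begin
      isoCountF (u ∷ us ++ T ∷ []) ss + ∑ (graftAllF T (u ∷ us)) (λ ys → isoCountF ys ss)
        ≡⟨ cong₂ _+_ (isoCountF-∷ˡ u (us ++ T ∷ []) ss) graftAllF-∷ ⟩
      G₀ + (G₁ + G₂)                                        ≡⟨ +-leftComm G₀ G₁ G₂ ⟩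
      G₁ + (G₀ + G₂)                                        ≡⟨ cong₂ _+_ cutInside cutOutside ⟩
      ∑ˢ ss (λ z r → ∑ (cuts z) (λ (x , y) → h x y r)) + ∑ˢ ss (λ z r → ∑ (cutsF r) (λ (x , r′) → h x z r′))
        ≡⟨ ∑-distrib-+ (select ss) _ _ ⟨
      ∑ˢ ss (λ z r → ∑ (cuts z) (λ (x , y) → h x y r) + ∑ (cutsF r) (λ (x , r′) → h x z r′))
        ≡⟨ ∑-cutsF-∑ˢ ss h ⟨
      ∑ (cutsF ss) (λ (x , r) → ∑ˢ r (h x))
        ≡⟨ ∑-cong (cutsF ss) (λ (x , r) → trans (sym (*-distribˡ-∑ (isoCount T x) (select r) _)) (cong (isoCount T x *_) (sym (isoCountF-∷ˡ u us r)))) ⟩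
      ∑ (cutsF ss) (λ (A , r) → isoCount T A * isoCountF (u ∷ us) r) ∎
      where
      h : Tree → Tree → List Tree → ℕ
      h x y r = isoCount T x * (isoCount u y * isoCountF us r)
      G₀ = ∑ˢ ss (λ z r → isoCount u z * isoCountF (us ++ T ∷ []) r)
      G₁ = ∑ (graftAll T u) (λ Y → isoCountF (Y ∷ us) ss)
      G₂ = ∑ (graftAllF T us) (λ ys → isoCountF (u ∷ ys) ss)
      graftAllF-∷ : ∑ (graftAllF T (u ∷ us)) (λ ys → isoCountF ys ss) ≡ G₁ + G₂
      graftAllF-∷ = trans (∑-++ (map _ (graftAll T u)) (map _ (graftAllF T us)) _)
                          (cong₂ _+_ (∑-map _ (graftAll T u) _) (∑-map _ (graftAllF T us) _))
      cutInside : G₁ ≡ ∑ˢ ss (λ z r → ∑ (cuts z) (λ (x , y) → h x y r))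
      cutInside = begin
        G₁                                                                ≡⟨ ∑-cong (graftAll T u) (λ Y → isoCountF-∷ˡ Y us ss) ⟩
        ∑ (graftAll T u) (λ Y → ∑ˢ ss (λ z r → isoCount Y z * isoCountF us r))
          ≡⟨ ∑-comm (graftAll T u) (select ss) _ ⟩
        ∑ˢ ss (λ z r → ∑ (graftAll T u) (λ Y → isoCount Y z * isoCountF us r))
          ≡⟨ ∑ˢ-cong ss (λ z r → sym (*-distribʳ-∑ (isoCountF us r) (graftAll T u) (λ Y → isoCount Y z))) ⟩
        ∑ˢ ss (λ z r → ∑ (graftAll T u) (λ Y → isoCount Y z) * isoCountF us r)
          ≡⟨ ∑ˢ-cong ss (λ z r → cong (_* isoCountF us r) (∑-graftAll-isoCount T u z)) ⟩
        ∑ˢ ss (λ z r → ∑ (cuts z) (λ (x , y) → isoCount T x * isoCount u y) * isoCountF us r)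
          ≡⟨ ∑ˢ-cong ss (λ z r → trans (*-distribʳ-∑ (isoCountF us r) (cuts z) _)
               (∑-cong (cuts z) (λ (x , y) → *-assoc (isoCount T x) (isoCount u y) (isoCountF us r)))) ⟩
        ∑ˢ ss (λ z r → ∑ (cuts z) (λ (x , y) → h x y r)) ∎
      cutOutside : G₀ + G₂ ≡ ∑ˢ ss (λ z r → ∑ (cutsF r) (λ (x , r′) → h x z r′))
      cutOutside = begin
        G₀ + G₂
          ≡⟨ cong (G₀ +_) (trans (∑-cong (graftAllF T us) (λ ys → isoCountF-∷ˡ u ys ss)) (∑-comm (graftAllF T us) (select ss) _)) ⟩
        G₀ + ∑ˢ ss (λ z r → ∑ (graftAllF T us) (λ ys → isoCount u z * isoCountF ys r))
          ≡⟨ ∑-distrib-+ (select ss) _ _ ⟨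
        ∑ˢ ss (λ z r → isoCount u z * isoCountF (us ++ T ∷ []) r + ∑ (graftAllF T us) (λ ys → isoCount u z * isoCountF ys r))
          ≡⟨ ∑ˢ-cong ss (λ z r → trans (cong (isoCount u z * isoCountF (us ++ T ∷ []) r +_)
                                             (sym (*-distribˡ-∑ (isoCount u z) (graftAllF T us) (λ ys → isoCountF ys r))))
                                      (trans (sym (*-distribˡ-+ (isoCount u z) _ _))
                                             (cong (isoCount u z *_) (∑-graftAllF-isoCountF T us r)))) ⟩
        ∑ˢ ss (λ z r → isoCount u z * ∑ (cutsF r) (λ (x , r′) → isoCount T x * isoCountF us r′))
          ≡⟨ ∑ˢ-cong ss (λ z r → trans (*-distribˡ-∑ (isoCount u z) (cutsF r) _)
               (∑-cong (cutsF r) (λ (x , r′) → *-leftComm (isoCount u z) (isoCount T x) (isoCountF us r′)))) ⟩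
        ∑ˢ ss (λ z r → ∑ (cutsF r) (λ (x , r′) → h x z r′)) ∎

  ≅⇒≅ᵇ : ∀ T U → T ≅ U → T ≅ᵇ U ≡ true
  ≅⇒≅ᵇ T U T≅U with isoCount T U
  ... | zero  = ⊥-elim (T≅U refl)
  ... | suc _ = refl

  ≅ᵇ⇒≅ : ∀ T U → T ≅ᵇ U ≡ true → T ≅ U
  ≅ᵇ⇒≅ T U T≅ᵇU with isoCount T U
  ≅ᵇ⇒≅ T U () | zero

  ≇ᵇ⇒isoCount≡0 : ∀ T U → T ≅ᵇ U ≡ false → isoCount T U ≡ 0
  ≇ᵇ⇒isoCount≡0 T U T≇ᵇU with isoCount T U
  ... | zero = refl
  ≇ᵇ⇒isoCount≡0 T U () | suc _

  ≅⇒IsTrue : ∀ T U → T ≅ U → IsTrue (T ≅ᵇ U)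
  ≅⇒IsTrue T U T≅U = Equivalence.from T-≡ (≅⇒≅ᵇ T U T≅U)

  IsTrue⇒≅ : ∀ T U → IsTrue (T ≅ᵇ U) → T ≅ U
  IsTrue⇒≅ T U t = ≅ᵇ⇒≅ T U (Equivalence.to T-≡ t)

  countᵇ-≅ᵇ*autCount : ∀ (L : List Tree) X → countᵇ (_≅ᵇ X) L * autCount X ≡ ∑ L (λ Y → isoCount Y X)
  countᵇ-≅ᵇ*autCount []      X = refl
  countᵇ-≅ᵇ*autCount (Y ∷ L) X with Y ≅ᵇ X in Y≅ᵇX
  ... | true  = cong₂ _+_ (sym (≅⇒isoCount≡ Y X X (≅ᵇ⇒≅ Y X Y≅ᵇX))) (countᵇ-≅ᵇ*autCount L X)
  ... | false = trans (countᵇ-≅ᵇ*autCount L X) (cong (_+ ∑ L (λ Y → isoCount Y X)) (sym (≇ᵇ⇒isoCount≡0 Y X Y≅ᵇX)))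

  graftCoeff*autCount : ∀ T T′ X →
    graftCoeff T T′ X * autCount X ≡ ∑ (cuts X) (λ (A , B) → isoCount T A * isoCount T′ B)
  graftCoeff*autCount T T′ X = trans (countᵇ-≅ᵇ*autCount (graftAll T T′) X) (∑-graftAll-isoCount T T′ X)

  mutual
    treesF-size : ∀ f n → All (λ T → size T ≡ n) (treesF f n)
    treesF-size zero    n       = []
    treesF-size (suc f) zero    = []
    treesF-size (suc f) (suc n) = All.map⁺ (All.map (cong suc) (forestsF-size f n))

    forestsF-size : ∀ f m → All (λ ts → sizeF ts ≡ m) (forestsF f m)
    forestsF-size f       zero    = refl ∷ []
    forestsF-size zero    (suc m) = []
    forestsF-size (suc f) (suc m) =
      concatMap⁺ (All.applyUpTo⁺₁ id (suc m) λ {k} k≤m → concatMap⁺ (All.map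
        (λ {t} t≡1+k → All.map⁺ (All.map (λ ts≡m∸k → trans (cong₂ _+_ t≡1+k ts≡m∸k) (cong suc (m+[n∸m]≡n (≤-pred k≤m))))
                               (forestsF-size f (m ∸ k))))
        (treesF-size (suc f) (suc k))))
      where
      concatMap⁺ : ∀ {A B : Set} {P : B → Set} {g : A → List B} {xs} → All (All P ∘ g) xs → All P (concatMap g xs)
      concatMap⁺ = All.concat⁺ ∘ All.map⁺

  mutual
    treesF-complete : ∀ T f → size T ≤ f → Any (_≡ T) (treesF f (size T))
    treesF-complete (node ts) (suc f) (s≤s ts≤f) = Any.map⁺ (Any.map (cong node) (forestsF-complete ts f ts≤f))

    forestsF-complete : ∀ ts f → sizeF ts ≤ f → Any (_≡ ts) (forestsF f (sizeF ts))
    forestsF-complete []             f       _ = here refl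
    forestsF-complete (node cs ∷ ts) (suc f) (s≤s cs+ts≤f) =
      Any.concatMap⁺ _ (Any.applyUpTo⁺ id
        (Any.concatMap⁺ _ (Any.map (λ { refl → Any.map⁺ (Any.map (cong (node cs ∷_)) rest) })
          (treesF-complete (node cs) (suc f) (s≤s (≤-trans (m≤m+n (sizeF cs) (sizeF ts)) cs+ts≤f)))))
        (s≤s (m≤m+n (sizeF cs) (sizeF ts))))
      where
      rest : Any (_≡ ts) (forestsF f (sizeF cs + sizeF ts ∸ sizeF cs))
      rest = subst (λ n → Any (_≡ ts) (forestsF f n)) (sym (m+n∸m≡n (sizeF cs) (sizeF ts)))
                   (forestsF-complete ts f (≤-trans (m≤n+m (sizeF ts) (sizeF cs)) cs+ts≤f))

  ∈-trees : ∀ T → Any (_≡ T) (trees (size T))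
  ∈-trees T = treesF-complete T (size T) ≤-refl

  classes-size : ∀ n → All (λ T → size T ≡ n) (classes n)
  classes-size n = All.deduplicate⁺ _ (treesF-size n n)

  mutual
    cuts-size : ∀ X → All (λ (A , B) → size A + size B ≡ size X) (cuts X)
    cuts-size (node ss) = All.map⁺ (All.map (λ {(A , r)} A+r≡ss → trans (+-suc (size A) (sizeF r)) (cong suc A+r≡ss)) (cutsF-size ss))

    cutsF-size : ∀ ss → All (λ (A , r) → size A + sizeF r ≡ sizeF ss) (cutsF ss)
    cutsF-size []       = []
    cutsF-size (s ∷ ss) = refl ∷ All.++⁺
      (All.map⁺ (All.map (λ {(A , B)} A+B≡s → trans (sym (+-assoc (size A) (size B) (sizeF ss))) (cong (_+ sizeF ss) A+B≡s)) (cuts-size s)))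
      (All.map⁺ (All.map (λ {(A , r)} A+r≡ss → trans (+-leftComm (size A) (size s) (sizeF r)) (cong (size s +_) A+r≡ss)) (cutsF-size ss)))

  size>0 : ∀ T → 0 < size T
  size>0 (node _) = s≤s z≤n

  cuts-size< : ∀ X → All (λ (A , B) → size A < size X × size B < size X) (cuts X)
  cuts-size< X = All.map (λ {(A , B)} A+B≡X →
      subst (size A <_) A+B≡X (m<m+n (size A) (size>0 B)) , subst (size B <_) A+B≡X (m<n+m (size B) (size>0 A)))
    (cuts-size X)

  allClasses : ℕ → List Tree
  allClasses N = concatMap classes (upTo N)

open Combinatorics

module Polynomials {c ℓ : Level} (F : Field c ℓ) where
  open Field F
  open FieldOps F
  open ListSum commutativeSemiring
  open import Relation.Binary.Reasoning.Setoid setoid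
  open import Algebra.Properties.CommutativeSemigroup +-commutativeSemigroup
    using () renaming (interchange to +-interchange; x∙yz≈y∙xz to +-leftComm)
  open import Algebra.Properties.CommutativeSemigroup *-commutativeSemigroup
    using () renaming (x∙yz≈y∙xz to *-leftComm)
  module ℕ∑ = ListSum ℕ.+-*-commutativeSemiring

  private variable
    a : Level
    A : Set a

  ι-cong : ∀ {m n} → m ≡ n → ι m ≈ ι n
  ι-cong ≡.refl = refl

  ι-+ : ∀ m n → ι (m ℕ.+ n) ≈ ι m + ι n
  ι-+ zero    n = sym (+-identityˡ _)
  ι-+ (suc m) n = trans (+-congˡ (ι-+ m n)) (sym (+-assoc _ _ _))

  ι-* : ∀ m n → ι (m ℕ.* n) ≈ ι m * ι n
  ι-* zero    n = sym (zeroˡ _)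
  ι-* (suc m) n = trans (ι-+ n (m ℕ.* n)) (trans (+-cong (sym (*-identityˡ _)) (ι-* m n)) (sym (distribʳ _ _ _)))

  ι-∑ : ∀ (xs : List A) f → ι (ℕ∑.∑ xs f) ≈ ∑ xs (ι ∘ f)
  ι-∑ []       f = refl
  ι-∑ (x ∷ xs) f = trans (ι-+ (f x) _) (+-congˡ (ι-∑ xs f))

  coeff-⊕ : ∀ p q n → coeff (p ⊕ q) n ≈ coeff p n + coeff q n
  coeff-⊕ []      q       n       = sym (+-identityˡ _)
  coeff-⊕ (x ∷ p) []      zero    = sym (+-identityʳ _)
  coeff-⊕ (x ∷ p) []      (suc n) = sym (+-identityʳ _)
  coeff-⊕ (x ∷ p) (y ∷ q) zero    = refl
  coeff-⊕ (x ∷ p) (y ∷ q) (suc n) = coeff-⊕ p q n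

  coeff-scale : ∀ k p n → coeff (scale k p) n ≈ k * coeff p n
  coeff-scale k []      n       = sym (zeroʳ k)
  coeff-scale k (x ∷ p) zero    = refl
  coeff-scale k (x ∷ p) (suc n) = coeff-scale k p n

  ∑ₚ : List A → (A → Poly) → Poly
  ∑ₚ xs f = sumP (map f xs)

  coeff-∑ₚ : ∀ (xs : List A) f n → coeff (∑ₚ xs f) n ≈ ∑ xs (λ x → coeff (f x) n)
  coeff-∑ₚ []       f n = refl
  coeff-∑ₚ (x ∷ xs) f n = trans (coeff-⊕ (f x) _ n) (+-congˡ (coeff-∑ₚ xs f n))

  coeff-sumP : ∀ ps n → coeff (sumP ps) n ≈ ∑ ps (λ p → coeff p n)
  coeff-sumP []       n = refl
  coeff-sumP (p ∷ ps) n = trans (coeff-⊕ p (sumP ps) n) (+-congˡ (coeff-sumP ps n))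

  -- Equality of polynomials is coefficientwise, so Agda cannot infer polynomials from it;
  -- congruence lemmas therefore take the polynomials explicitly.
  ⊕-cong : ∀ p p′ q q′ → p ≈ₚ p′ → q ≈ₚ q′ → (p ⊕ q) ≈ₚ (p′ ⊕ q′)
  ⊕-cong p p′ q q′ e f n = trans (coeff-⊕ p q n) (trans (+-cong (e n) (f n)) (sym (coeff-⊕ p′ q′ n)))

  ⊕-assoc : ∀ p q r → ((p ⊕ q) ⊕ r) ≈ₚ (p ⊕ (q ⊕ r))
  ⊕-assoc p q r n = begin
    coeff ((p ⊕ q) ⊕ r) n                  ≈⟨ trans (coeff-⊕ (p ⊕ q) r n) (+-congʳ (coeff-⊕ p q n)) ⟩
    (coeff p n + coeff q n) + coeff r n    ≈⟨ +-assoc _ _ _ ⟩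
    coeff p n + (coeff q n + coeff r n)    ≈⟨ trans (coeff-⊕ p (q ⊕ r) n) (+-congˡ (coeff-⊕ q r n)) ⟨
    coeff (p ⊕ (q ⊕ r)) n                  ∎

  scale-cong : ∀ k k′ p p′ → k ≈ k′ → p ≈ₚ p′ → scale k p ≈ₚ scale k′ p′
  scale-cong k k′ p p′ e f n = trans (coeff-scale k p n) (trans (*-cong e (f n)) (sym (coeff-scale k′ p′ n)))

  ∑ₚ-congᴬ : ∀ {xs : List A} {f g} → All (λ x → f x ≈ₚ g x) xs → ∑ₚ xs f ≈ₚ ∑ₚ xs g
  ∑ₚ-congᴬ {xs = []}     []       n = refl
  ∑ₚ-congᴬ {xs = x ∷ xs} {f} {g} (e ∷ es) = ⊕-cong (f x) (g x) (∑ₚ xs f) (∑ₚ xs g) e (∑ₚ-congᴬ es)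

  ∑ₚ-cong : ∀ (xs : List A) {f g} → (∀ x → f x ≈ₚ g x) → ∑ₚ xs f ≈ₚ ∑ₚ xs g
  ∑ₚ-cong xs e = ∑ₚ-congᴬ (All.universal e xs)

  ∑ₚ-map : ∀ {b} {B : Set b} (g : A → B) xs f → ∑ₚ (map g xs) f ≡ ∑ₚ xs (f ∘ g)
  ∑ₚ-map g []       f = ≡.refl
  ∑ₚ-map g (x ∷ xs) f = ≡.cong (f (g x) ⊕_) (∑ₚ-map g xs f)

  ∑ₚ-++ : ∀ (xs ys : List A) f → ∑ₚ (xs ++ ys) f ≈ₚ (∑ₚ xs f ⊕ ∑ₚ ys f)
  ∑ₚ-++ []       ys f n = refl
  ∑ₚ-++ (x ∷ xs) ys f n = begin
    coeff (f x ⊕ ∑ₚ (xs ++ ys) f) n                  ≈⟨ trans (coeff-⊕ (f x) _ n) (+-congˡ (∑ₚ-++ xs ys f n)) ⟩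
    coeff (f x) n + coeff (∑ₚ xs f ⊕ ∑ₚ ys f) n      ≈⟨ +-congˡ (coeff-⊕ (∑ₚ xs f) (∑ₚ ys f) n) ⟩
    coeff (f x) n + (coeff (∑ₚ xs f) n + coeff (∑ₚ ys f) n)  ≈⟨ +-assoc _ _ _ ⟨
    (coeff (f x) n + coeff (∑ₚ xs f) n) + coeff (∑ₚ ys f) n  ≈⟨ trans (coeff-⊕ (f x ⊕ ∑ₚ xs f) _ n) (+-congʳ (coeff-⊕ (f x) _ n)) ⟨
    coeff ((f x ⊕ ∑ₚ xs f) ⊕ ∑ₚ ys f) n              ∎

  eval-0 : ∀ p → eval p 0# ≈ coeff p 0
  eval-0 []      = refl
  eval-0 (k ∷ p) = trans (+-congˡ (zeroˡ _)) (+-identityʳ k)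

  coeff-zipWith-applyUpTo : ∀ (f : ℕ → Carrier → Carrier) g p n → (∀ i → f i 0# ≈ 0#) →
    coeff (zipWith f (applyUpTo g (length p)) p) n ≈ f (g n) (coeff p n)
  coeff-zipWith-applyUpTo f g []      n       f0 = sym (f0 (g n))
  coeff-zipWith-applyUpTo f g (x ∷ p) zero    f0 = refl
  coeff-zipWith-applyUpTo f g (x ∷ p) (suc n) f0 = coeff-zipWith-applyUpTo f (g ∘ suc) p n f0

  coeff-map-applyUpTo : ∀ (h : ℕ → Carrier) g n j → (∀ {j} → n ≤ j → h (g j) ≈ 0#) →
    coeff (map h (applyUpTo g n)) j ≈ h (g j)
  coeff-map-applyUpTo h g zero    j       h0 = sym (h0 z≤n)
  coeff-map-applyUpTo h g (suc n) zero    h0 = refl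
  coeff-map-applyUpTo h g (suc n) (suc j) h0 = coeff-map-applyUpTo h (g ∘ suc) n j (h0 ∘ s≤s)

  coeff-deriv : ∀ p n → coeff (deriv p) n ≈ ι (suc n) * coeff p (suc n)
  coeff-deriv []      n = sym (zeroʳ _)
  coeff-deriv (x ∷ p) n = coeff-zipWith-applyUpTo (λ i k → ι (suc i) * k) (λ i → i) p n (λ _ → zeroʳ _)

  coeff-integ : ∀ p n → coeff (integ p) (suc n) ≈ ι (suc n) ⁻¹ * coeff p n
  coeff-integ p n = coeff-zipWith-applyUpTo (λ i k → ι (suc i) ⁻¹ * k) (λ i → i) p n (λ _ → zeroʳ _)

  deriv-cong : ∀ p q → p ≈ₚ q → deriv p ≈ₚ deriv q
  deriv-cong p q e n = trans (coeff-deriv p n) (trans (*-congˡ (e (suc n))) (sym (coeff-deriv q n)))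

  integ-cong : ∀ p q → p ≈ₚ q → integ p ≈ₚ integ q
  integ-cong p q e zero    = refl
  integ-cong p q e (suc n) = trans (coeff-integ p n) (trans (*-congˡ (e n)) (sym (coeff-integ q n)))

  deriv-⊕ : ∀ p q → deriv (p ⊕ q) ≈ₚ (deriv p ⊕ deriv q)
  deriv-⊕ p q n = begin
    coeff (deriv (p ⊕ q)) n                                       ≈⟨ coeff-deriv (p ⊕ q) n ⟩
    ι (suc n) * coeff (p ⊕ q) (suc n)                             ≈⟨ trans (*-congˡ (coeff-⊕ p q (suc n))) (distribˡ _ _ _) ⟩
    ι (suc n) * coeff p (suc n) + ι (suc n) * coeff q (suc n)     ≈⟨ +-cong (coeff-deriv p n) (coeff-deriv q n) ⟨
    coeff (deriv p) n + coeff (deriv q) n                         ≈⟨ coeff-⊕ (deriv p) (deriv q) n ⟨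
    coeff (deriv p ⊕ deriv q) n                                   ∎

  deriv-scale : ∀ k p → deriv (scale k p) ≈ₚ scale k (deriv p)
  deriv-scale k p n = begin
    coeff (deriv (scale k p)) n             ≈⟨ trans (coeff-deriv (scale k p) n) (*-congˡ (coeff-scale k p (suc n))) ⟩
    ι (suc n) * (k * coeff p (suc n))       ≈⟨ *-leftComm _ _ _ ⟩
    k * (ι (suc n) * coeff p (suc n))       ≈⟨ trans (coeff-scale k (deriv p) n) (*-congˡ (coeff-deriv p n)) ⟨
    coeff (scale k (deriv p)) n             ∎

  integ-⊕ : ∀ p q → integ (p ⊕ q) ≈ₚ (integ p ⊕ integ q)
  integ-⊕ p q zero    = sym (+-identityʳ 0#)
  integ-⊕ p q (suc n) = begin
    coeff (integ (p ⊕ q)) (suc n)                     ≈⟨ trans (coeff-integ (p ⊕ q) n) (*-congˡ (coeff-⊕ p q n)) ⟩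
    ι (suc n) ⁻¹ * (coeff p n + coeff q n)            ≈⟨ distribˡ _ _ _ ⟩
    ι (suc n) ⁻¹ * coeff p n + ι (suc n) ⁻¹ * coeff q n ≈⟨ +-cong (coeff-integ p n) (coeff-integ q n) ⟨
    coeff (integ p) (suc n) + coeff (integ q) (suc n) ≈⟨ coeff-⊕ (integ p) (integ q) (suc n) ⟨
    coeff (integ p ⊕ integ q) (suc n)                 ∎

  deriv-∑ₚ : ∀ (xs : List A) f → deriv (∑ₚ xs f) ≈ₚ ∑ₚ xs (deriv ∘ f)
  deriv-∑ₚ []       f n = refl
  deriv-∑ₚ (x ∷ xs) f n =
    trans (deriv-⊕ (f x) (∑ₚ xs f) n) (⊕-cong (deriv (f x)) (deriv (f x)) (deriv (∑ₚ xs f)) (∑ₚ xs (deriv ∘ f)) (λ _ → refl) (deriv-∑ₚ xs f) n)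

  ⊕-identityʳ : ∀ p → (p ⊕ []) ≈ₚ p
  ⊕-identityʳ p n = trans (coeff-⊕ p [] n) (+-identityʳ _)

  coeff-∷-⊗ : ∀ x p q n → coeff ((x ∷ p) ⊗ q) n ≈ x * coeff q n + coeff (0# ∷ (p ⊗ q)) n
  coeff-∷-⊗ x p q n = trans (coeff-⊕ (scale x q) (0# ∷ (p ⊗ q)) n) (+-congʳ (coeff-scale x q n))

  coeff-0∷-⊕ : ∀ p q r → p ≈ₚ (q ⊕ r) → ∀ n → coeff (0# ∷ p) n ≈ coeff (0# ∷ q) n + coeff (0# ∷ r) n
  coeff-0∷-⊕ p q r e zero    = sym (+-identityʳ 0#)
  coeff-0∷-⊕ p q r e (suc n) = trans (e n) (coeff-⊕ q r n)

  coeff-0∷-scale : ∀ k p q → p ≈ₚ scale k q → ∀ n → coeff (0# ∷ p) n ≈ k * coeff (0# ∷ q) n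
  coeff-0∷-scale k p q e zero    = sym (zeroʳ k)
  coeff-0∷-scale k p q e (suc n) = trans (e n) (coeff-scale k q n)

  ⊗-zeroˡ : ∀ p q → p ≈ₚ [] → (p ⊗ q) ≈ₚ []
  ⊗-zeroˡ []      q e n = refl
  ⊗-zeroˡ (x ∷ p) q e n =
    trans (coeff-∷-⊗ x p q n) (trans (+-cong (trans (*-congʳ (e 0)) (zeroˡ _)) (tail n)) (+-identityˡ 0#))
    where
    tail : ∀ n → coeff (0# ∷ (p ⊗ q)) n ≈ 0#
    tail zero    = refl
    tail (suc n) = ⊗-zeroˡ p q (e ∘ suc) n

  ⊗-congˡ : ∀ p p′ q → p ≈ₚ p′ → (p ⊗ q) ≈ₚ (p′ ⊗ q)
  ⊗-congˡ []      []       q e n = refl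
  ⊗-congˡ []      (y ∷ p′) q e n = sym (⊗-zeroˡ (y ∷ p′) q (λ m → sym (e m)) n)
  ⊗-congˡ (x ∷ p) []       q e n = ⊗-zeroˡ (x ∷ p) q e n
  ⊗-congˡ (x ∷ p) (y ∷ p′) q e =
    ⊕-cong (scale x q) (scale y q) _ _ (scale-cong x y q q (e 0) (λ _ → refl)) λ where
      zero    → refl
      (suc n) → ⊗-congˡ p p′ q (e ∘ suc) n

  ⊗-congʳ : ∀ p q q′ → q ≈ₚ q′ → (p ⊗ q) ≈ₚ (p ⊗ q′)
  ⊗-congʳ []      q q′ e n = refl
  ⊗-congʳ (x ∷ p) q q′ e =
    ⊕-cong (scale x q) (scale x q′) _ _ (scale-cong x x q q′ refl e) λ where
      zero    → refl
      (suc n) → ⊗-congʳ p q q′ e n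

  ⊗-distribʳ-⊕ : ∀ p p′ q → ((p ⊕ p′) ⊗ q) ≈ₚ ((p ⊗ q) ⊕ (p′ ⊗ q))
  ⊗-distribʳ-⊕ []      p′       q n = refl
  ⊗-distribʳ-⊕ (x ∷ p) []       q n = sym (⊕-identityʳ ((x ∷ p) ⊗ q) n)
  ⊗-distribʳ-⊕ (x ∷ p) (y ∷ p′) q n = begin
    coeff (((x + y) ∷ (p ⊕ p′)) ⊗ q) n
      ≈⟨ coeff-∷-⊗ (x + y) (p ⊕ p′) q n ⟩
    (x + y) * coeff q n + coeff (0# ∷ ((p ⊕ p′) ⊗ q)) n
      ≈⟨ +-cong (distribʳ _ _ _) (coeff-0∷-⊕ _ _ _ (⊗-distribʳ-⊕ p p′ q) n) ⟩
    (x * coeff q n + y * coeff q n) + (coeff (0# ∷ (p ⊗ q)) n + coeff (0# ∷ (p′ ⊗ q)) n)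
      ≈⟨ +-interchange _ _ _ _ ⟩
    (x * coeff q n + coeff (0# ∷ (p ⊗ q)) n) + (y * coeff q n + coeff (0# ∷ (p′ ⊗ q)) n)
      ≈⟨ +-cong (coeff-∷-⊗ x p q n) (coeff-∷-⊗ y p′ q n) ⟨
    coeff ((x ∷ p) ⊗ q) n + coeff ((y ∷ p′) ⊗ q) n
      ≈⟨ coeff-⊕ ((x ∷ p) ⊗ q) ((y ∷ p′) ⊗ q) n ⟨
    coeff (((x ∷ p) ⊗ q) ⊕ ((y ∷ p′) ⊗ q)) n ∎

  ⊗-distribˡ-⊕ : ∀ p q q′ → (p ⊗ (q ⊕ q′)) ≈ₚ ((p ⊗ q) ⊕ (p ⊗ q′))
  ⊗-distribˡ-⊕ []      q q′ n = refl
  ⊗-distribˡ-⊕ (x ∷ p) q q′ n = begin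
    coeff ((x ∷ p) ⊗ (q ⊕ q′)) n
      ≈⟨ coeff-∷-⊗ x p (q ⊕ q′) n ⟩
    x * coeff (q ⊕ q′) n + coeff (0# ∷ (p ⊗ (q ⊕ q′))) n
      ≈⟨ +-cong (trans (*-congˡ (coeff-⊕ q q′ n)) (distribˡ _ _ _)) (coeff-0∷-⊕ _ _ _ (⊗-distribˡ-⊕ p q q′) n) ⟩
    (x * coeff q n + x * coeff q′ n) + (coeff (0# ∷ (p ⊗ q)) n + coeff (0# ∷ (p ⊗ q′)) n)
      ≈⟨ +-interchange _ _ _ _ ⟩
    (x * coeff q n + coeff (0# ∷ (p ⊗ q)) n) + (x * coeff q′ n + coeff (0# ∷ (p ⊗ q′)) n)
      ≈⟨ +-cong (coeff-∷-⊗ x p q n) (coeff-∷-⊗ x p q′ n) ⟨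
    coeff ((x ∷ p) ⊗ q) n + coeff ((x ∷ p) ⊗ q′) n
      ≈⟨ coeff-⊕ ((x ∷ p) ⊗ q) ((x ∷ p) ⊗ q′) n ⟨
    coeff (((x ∷ p) ⊗ q) ⊕ ((x ∷ p) ⊗ q′)) n ∎

  ⊗-scaleˡ : ∀ k p q → (scale k p ⊗ q) ≈ₚ scale k (p ⊗ q)
  ⊗-scaleˡ k []      q n = refl
  ⊗-scaleˡ k (x ∷ p) q n = begin
    coeff ((k * x ∷ scale k p) ⊗ q) n
      ≈⟨ coeff-∷-⊗ (k * x) (scale k p) q n ⟩
    (k * x) * coeff q n + coeff (0# ∷ (scale k p ⊗ q)) n
      ≈⟨ +-cong (*-assoc _ _ _) (coeff-0∷-scale k _ _ (⊗-scaleˡ k p q) n) ⟩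
    k * (x * coeff q n) + k * coeff (0# ∷ (p ⊗ q)) n
      ≈⟨ trans (sym (distribˡ _ _ _)) (*-congˡ (sym (coeff-∷-⊗ x p q n))) ⟩
    k * coeff ((x ∷ p) ⊗ q) n
      ≈⟨ coeff-scale k ((x ∷ p) ⊗ q) n ⟨
    coeff (scale k ((x ∷ p) ⊗ q)) n ∎

  ⊗-scaleʳ : ∀ k p q → (p ⊗ scale k q) ≈ₚ scale k (p ⊗ q)
  ⊗-scaleʳ k []      q n = refl
  ⊗-scaleʳ k (x ∷ p) q n = begin
    coeff ((x ∷ p) ⊗ scale k q) n
      ≈⟨ coeff-∷-⊗ x p (scale k q) n ⟩
    x * coeff (scale k q) n + coeff (0# ∷ (p ⊗ scale k q)) n
      ≈⟨ +-cong (trans (*-congˡ (coeff-scale k q n)) (*-leftComm _ _ _)) (coeff-0∷-scale k _ _ (⊗-scaleʳ k p q) n) ⟩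
    k * (x * coeff q n) + k * coeff (0# ∷ (p ⊗ q)) n
      ≈⟨ trans (sym (distribˡ _ _ _)) (*-congˡ (sym (coeff-∷-⊗ x p q n))) ⟩
    k * coeff ((x ∷ p) ⊗ q) n
      ≈⟨ coeff-scale k ((x ∷ p) ⊗ q) n ⟨
    coeff (scale k ((x ∷ p) ⊗ q)) n ∎

  ⊗-zeroʳ : ∀ p → (p ⊗ []) ≈ₚ []
  ⊗-zeroʳ []      n       = refl
  ⊗-zeroʳ (x ∷ p) zero    = refl
  ⊗-zeroʳ (x ∷ p) (suc n) = ⊗-zeroʳ p n

  ⊗-identityʳ : ∀ p → (p ⊗ onePoly) ≈ₚ p
  ⊗-identityʳ []      n       = refl
  ⊗-identityʳ (x ∷ p) zero    = trans (+-identityʳ _) (*-identityʳ x)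
  ⊗-identityʳ (x ∷ p) (suc n) = ⊗-identityʳ p n

  constant-⊗ : ∀ k q → ((k ∷ []) ⊗ q) ≈ₚ scale k q
  constant-⊗ k q n = trans (coeff-∷-⊗ k [] q n) (trans (+-congˡ (tail n)) (trans (+-identityʳ _) (sym (coeff-scale k q n))))
    where
    tail : ∀ n → coeff (0# ∷ []) n ≈ 0#
    tail zero    = refl
    tail (suc n) = refl

  coeff₀-integ-⊗ : ∀ p q → coeff (integ p ⊗ q) 0 ≈ 0#
  coeff₀-integ-⊗ p q = trans (coeff-∷-⊗ 0# (zipWith (λ i k → ι (suc i) ⁻¹ * k) (upTo (length p)) p) q 0)
                             (trans (+-identityʳ _) (zeroˡ _))

  ⊗-distribˡ-∑ₚ : ∀ p (xs : List A) f → (p ⊗ ∑ₚ xs f) ≈ₚ ∑ₚ xs (λ x → p ⊗ f x)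
  ⊗-distribˡ-∑ₚ p []       f = ⊗-zeroʳ p
  ⊗-distribˡ-∑ₚ p (x ∷ xs) f n = trans (⊗-distribˡ-⊕ p (f x) (∑ₚ xs f) n)
    (⊕-cong (p ⊗ f x) (p ⊗ f x) (p ⊗ ∑ₚ xs f) _ (λ _ → refl) (⊗-distribˡ-∑ₚ p xs f) n)

  ⊗-distribʳ-∑ₚ : ∀ (xs : List A) f q → (∑ₚ xs f ⊗ q) ≈ₚ ∑ₚ xs (λ x → f x ⊗ q)
  ⊗-distribʳ-∑ₚ []       f q n = refl
  ⊗-distribʳ-∑ₚ (x ∷ xs) f q n = trans (⊗-distribʳ-⊕ (f x) (∑ₚ xs f) q n)
    (⊕-cong (f x ⊗ q) (f x ⊗ q) (∑ₚ xs f ⊗ q) _ (λ _ → refl) (⊗-distribʳ-∑ₚ xs f q) n)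

  deriv-∷ : ∀ x p → deriv (x ∷ p) ≈ₚ (p ⊕ (0# ∷ deriv p))
  deriv-∷ x p n = begin
    coeff (deriv (x ∷ p)) n               ≈⟨ coeff-deriv (x ∷ p) n ⟩
    (1# + ι n) * coeff p n                ≈⟨ trans (distribʳ _ _ _) (+-congʳ (*-identityˡ _)) ⟩
    coeff p n + ι n * coeff p n           ≈⟨ +-congˡ (ι*coeff n) ⟩
    coeff p n + coeff (0# ∷ deriv p) n    ≈⟨ coeff-⊕ p (0# ∷ deriv p) n ⟨
    coeff (p ⊕ (0# ∷ deriv p)) n          ∎
    where
    ι*coeff : ∀ n → ι n * coeff p n ≈ coeff (0# ∷ deriv p) n
    ι*coeff zero    = zeroˡ _
    ι*coeff (suc n) = sym (coeff-deriv p n)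

  deriv-⊗ : ∀ p q → deriv (p ⊗ q) ≈ₚ ((deriv p ⊗ q) ⊕ (p ⊗ deriv q))
  deriv-⊗ []      q n = refl
  deriv-⊗ (x ∷ p) q n = begin
    coeff (deriv (scale x q ⊕ (0# ∷ (p ⊗ q)))) n
      ≈⟨ trans (deriv-⊕ (scale x q) (0# ∷ (p ⊗ q)) n) (coeff-⊕ (deriv (scale x q)) (deriv (0# ∷ (p ⊗ q))) n) ⟩
    coeff (deriv (scale x q)) n + coeff (deriv (0# ∷ (p ⊗ q))) n
      ≈⟨ +-cong (trans (deriv-scale x q n) (coeff-scale x (deriv q) n)) (trans (deriv-∷ 0# (p ⊗ q) n) (coeff-⊕ (p ⊗ q) _ n)) ⟩
    x * coeff (deriv q) n + (coeff (p ⊗ q) n + coeff (0# ∷ deriv (p ⊗ q)) n)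
      ≈⟨ +-congˡ (+-congˡ (coeff-0∷-⊕ _ _ _ (deriv-⊗ p q) n)) ⟩
    x * coeff (deriv q) n + (coeff (p ⊗ q) n + (coeff (0# ∷ (deriv p ⊗ q)) n + coeff (0# ∷ (p ⊗ deriv q)) n))
      ≈⟨ trans (+-leftComm _ _ _) (trans (+-congˡ (+-leftComm _ _ _)) (sym (+-assoc _ _ _))) ⟩
    (coeff (p ⊗ q) n + coeff (0# ∷ (deriv p ⊗ q)) n) + (x * coeff (deriv q) n + coeff (0# ∷ (p ⊗ deriv q)) n)
      ≈⟨ +-cong (trans (coeff-⊕ (p ⊗ q) ((0# ∷ deriv p) ⊗ q) n) (+-congˡ (trans (coeff-∷-⊗ 0# (deriv p) q n)
                   (trans (+-congʳ (zeroˡ _)) (+-identityˡ _)))))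
                (coeff-∷-⊗ x p (deriv q) n) ⟨
    coeff ((p ⊗ q) ⊕ ((0# ∷ deriv p) ⊗ q)) n + coeff ((x ∷ p) ⊗ deriv q) n
      ≈⟨ +-congʳ (trans (⊗-congˡ (deriv (x ∷ p)) (p ⊕ (0# ∷ deriv p)) q (deriv-∷ x p) n) (⊗-distribʳ-⊕ p (0# ∷ deriv p) q n)) ⟨
    coeff (deriv (x ∷ p) ⊗ q) n + coeff ((x ∷ p) ⊗ deriv q) n
      ≈⟨ coeff-⊕ (deriv (x ∷ p) ⊗ q) ((x ∷ p) ⊗ deriv q) n ⟨
    coeff ((deriv (x ∷ p) ⊗ q) ⊕ ((x ∷ p) ⊗ deriv q)) n ∎

  prodP-cong : ∀ (xs : List A) f g → (∀ x → f x ≈ₚ g x) → prodP (map f xs) ≈ₚ prodP (map g xs)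
  prodP-cong []       f g f≈g n = refl
  prodP-cong (t ∷ ts) f g f≈g n = trans (⊗-congˡ (f t) (g t) (prodP (map f ts)) (f≈g t) n)
                                            (⊗-congʳ (g t) (prodP (map f ts)) (prodP (map g ts)) (prodP-cong ts f g f≈g) n)

  module LinearExtension (e : ℕ → Poly) where

    -- The linear map tⁱ ↦ e i, applied to tˢ · p.
    linearFrom : ℕ → Poly → Poly
    linearFrom s []      = []
    linearFrom s (x ∷ p) = scale x (e s) ⊕ linearFrom (suc s) p

    coeff-linearFrom-∷ : ∀ s x p n → coeff (linearFrom s (x ∷ p)) n ≈ x * coeff (e s) n + coeff (linearFrom (suc s) p) n
    coeff-linearFrom-∷ s x p n = trans (coeff-⊕ (scale x (e s)) _ n) (+-congʳ (coeff-scale x (e s) n))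

    linearFrom-zero : ∀ s p → p ≈ₚ [] → linearFrom s p ≈ₚ []
    linearFrom-zero s []      p≈0 n = refl
    linearFrom-zero s (x ∷ p) p≈0 n = begin
      coeff (linearFrom s (x ∷ p)) n                          ≈⟨ coeff-linearFrom-∷ s x p n ⟩
      x * coeff (e s) n + coeff (linearFrom (suc s) p) n      ≈⟨ +-cong (trans (*-congʳ (p≈0 0)) (zeroˡ _)) (linearFrom-zero (suc s) p (p≈0 ∘ suc) n) ⟩
      0# + 0#                                                 ≈⟨ +-identityˡ 0# ⟩
      0#                                                      ∎

    linearFrom-cong : ∀ s p q → p ≈ₚ q → linearFrom s p ≈ₚ linearFrom s q
    linearFrom-cong s []      []      p≈q n = refl
    linearFrom-cong s []      (y ∷ q) p≈q n = sym (linearFrom-zero s (y ∷ q) (λ m → sym (p≈q m)) n)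
    linearFrom-cong s (x ∷ p) []      p≈q n = linearFrom-zero s (x ∷ p) p≈q n
    linearFrom-cong s (x ∷ p) (y ∷ q) p≈q =
      ⊕-cong (scale x (e s)) (scale y (e s)) _ _ (scale-cong x y (e s) (e s) (p≈q 0) (λ _ → refl))
             (linearFrom-cong (suc s) p q (p≈q ∘ suc))

    linearFrom-⊕ : ∀ s p q → linearFrom s (p ⊕ q) ≈ₚ (linearFrom s p ⊕ linearFrom s q)
    linearFrom-⊕ s []      q       n = refl
    linearFrom-⊕ s (x ∷ p) []      n = sym (⊕-identityʳ (linearFrom s (x ∷ p)) n)
    linearFrom-⊕ s (x ∷ p) (y ∷ q) n = begin
      coeff (linearFrom s ((x + y) ∷ (p ⊕ q))) n
        ≈⟨ coeff-linearFrom-∷ s (x + y) (p ⊕ q) n ⟩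
      (x + y) * coeff (e s) n + coeff (linearFrom (suc s) (p ⊕ q)) n
        ≈⟨ +-cong (distribʳ _ _ _) (trans (linearFrom-⊕ (suc s) p q n) (coeff-⊕ (linearFrom (suc s) p) _ n)) ⟩
      (x * coeff (e s) n + y * coeff (e s) n) + (coeff (linearFrom (suc s) p) n + coeff (linearFrom (suc s) q) n)
        ≈⟨ +-interchange _ _ _ _ ⟩
      (x * coeff (e s) n + coeff (linearFrom (suc s) p) n) + (y * coeff (e s) n + coeff (linearFrom (suc s) q) n)
        ≈⟨ +-cong (coeff-linearFrom-∷ s x p n) (coeff-linearFrom-∷ s y q n) ⟨
      coeff (linearFrom s (x ∷ p)) n + coeff (linearFrom s (y ∷ q)) n
        ≈⟨ coeff-⊕ (linearFrom s (x ∷ p)) (linearFrom s (y ∷ q)) n ⟨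
      coeff (linearFrom s (x ∷ p) ⊕ linearFrom s (y ∷ q)) n ∎

    linearFrom-scale : ∀ s k p → linearFrom s (scale k p) ≈ₚ scale k (linearFrom s p)
    linearFrom-scale s k []      n = refl
    linearFrom-scale s k (x ∷ p) n = begin
      coeff (linearFrom s (k * x ∷ scale k p)) n
        ≈⟨ coeff-linearFrom-∷ s (k * x) (scale k p) n ⟩
      (k * x) * coeff (e s) n + coeff (linearFrom (suc s) (scale k p)) n
        ≈⟨ +-cong (*-assoc _ _ _) (trans (linearFrom-scale (suc s) k p n) (coeff-scale k (linearFrom (suc s) p) n)) ⟩
      k * (x * coeff (e s) n) + k * coeff (linearFrom (suc s) p) n
        ≈⟨ trans (sym (distribˡ _ _ _)) (*-congˡ (sym (coeff-linearFrom-∷ s x p n))) ⟩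
      k * coeff (linearFrom s (x ∷ p)) n
        ≈⟨ coeff-scale k (linearFrom s (x ∷ p)) n ⟨
      coeff (scale k (linearFrom s (x ∷ p))) n ∎

    -- D (tᵐ · p) = tᵐ⁻¹ · weightFrom m p
    weightFrom : ℕ → Poly → Poly
    weightFrom m []      = []
    weightFrom m (x ∷ p) = ι m * x ∷ weightFrom (suc m) p

    coeff-weightFrom : ∀ m p n → coeff (weightFrom m p) n ≈ ι (m ℕ.+ n) * coeff p n
    coeff-weightFrom m []      n       = sym (zeroʳ _)
    coeff-weightFrom m (x ∷ p) zero    = *-congʳ (ι-cong (≡.sym (ℕ.+-identityʳ m)))
    coeff-weightFrom m (x ∷ p) (suc n) = trans (coeff-weightFrom (suc m) p n) (*-congʳ (ι-cong (≡.sym (ℕ.+-suc m n))))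

    deriv≈weightFrom : ∀ x p → deriv (x ∷ p) ≈ₚ weightFrom 1 p
    deriv≈weightFrom x p n = trans (coeff-deriv (x ∷ p) n) (sym (coeff-weightFrom 1 p n))

    module _ (deriv-e : ∀ m → deriv (e (suc m)) ≈ₚ scale (ι (suc m)) (e m)) where

      deriv-linearFrom : ∀ s p → deriv (linearFrom (suc s) p) ≈ₚ linearFrom s (weightFrom (suc s) p)
      deriv-linearFrom s []      n = refl
      deriv-linearFrom s (x ∷ p) n = begin
        coeff (deriv (scale x (e (suc s)) ⊕ linearFrom (suc (suc s)) p)) n
          ≈⟨ deriv-⊕ (scale x (e (suc s))) (linearFrom (suc (suc s)) p) n ⟩
        coeff (deriv (scale x (e (suc s))) ⊕ deriv (linearFrom (suc (suc s)) p)) n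
          ≈⟨ ⊕-cong (deriv (scale x (e (suc s)))) (scale (ι (suc s) * x) (e s)) (deriv (linearFrom (suc (suc s)) p)) _ deriv-head (deriv-linearFrom (suc s) p) n ⟩
        coeff (linearFrom s (weightFrom (suc s) (x ∷ p))) n ∎
        where
        deriv-head : deriv (scale x (e (suc s))) ≈ₚ scale (ι (suc s) * x) (e s)
        deriv-head m = begin
          coeff (deriv (scale x (e (suc s)))) m               ≈⟨ trans (deriv-scale x (e (suc s)) m) (coeff-scale x (deriv (e (suc s))) m) ⟩
          x * coeff (deriv (e (suc s))) m                     ≈⟨ *-congˡ (trans (deriv-e s m) (coeff-scale (ι (suc s)) (e s) m)) ⟩
          x * (ι (suc s) * coeff (e s) m)                     ≈⟨ trans (sym (*-assoc _ _ _)) (*-congʳ (*-comm _ _)) ⟩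
          (ι (suc s) * x) * coeff (e s) m                     ≈⟨ coeff-scale (ι (suc s) * x) (e s) m ⟨
          coeff (scale (ι (suc s) * x) (e s)) m               ∎

      deriv-linearFrom-0 : deriv (e 0) ≈ₚ [] → ∀ p → deriv (linearFrom 0 p) ≈ₚ linearFrom 0 (deriv p)
      deriv-linearFrom-0 e₀′≈0 []      n = refl
      deriv-linearFrom-0 e₀′≈0 (x ∷ p) n = begin
        coeff (deriv (scale x (e 0) ⊕ linearFrom 1 p)) n
          ≈⟨ trans (deriv-⊕ (scale x (e 0)) (linearFrom 1 p) n) (coeff-⊕ (deriv (scale x (e 0))) _ n) ⟩
        coeff (deriv (scale x (e 0))) n + coeff (deriv (linearFrom 1 p)) n
          ≈⟨ +-cong (trans (deriv-scale x (e 0) n) (trans (coeff-scale x (deriv (e 0)) n) (trans (*-congˡ (e₀′≈0 n)) (zeroʳ x))))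
                    (deriv-linearFrom 0 p n) ⟩
        0# + coeff (linearFrom 0 (weightFrom 1 p)) n
          ≈⟨ trans (+-identityˡ _) (linearFrom-cong 0 (weightFrom 1 p) (deriv (x ∷ p)) (λ m → sym (deriv≈weightFrom x p m)) n) ⟩
        coeff (linearFrom 0 (deriv (x ∷ p))) n ∎

  module CharacteristicZero (charZero : CharZero) where

    ι[1+n]⁻¹*ι[1+n] : ∀ n → ι (suc n) ⁻¹ * ι (suc n) ≈ 1#
    ι[1+n]⁻¹*ι[1+n] n = trans (*-comm _ _) (⁻¹-inverse (ι (suc n)) (charZero n))

    deriv-integ : ∀ p → deriv (integ p) ≈ₚ p
    deriv-integ p n = begin
      coeff (deriv (integ p)) n                    ≈⟨ trans (coeff-deriv (integ p) n) (*-congˡ (coeff-integ p n)) ⟩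
      ι (suc n) * (ι (suc n) ⁻¹ * coeff p n)        ≈⟨ sym (*-assoc _ _ _) ⟩
      (ι (suc n) * ι (suc n) ⁻¹) * coeff p n        ≈⟨ *-congʳ (⁻¹-inverse (ι (suc n)) (charZero n)) ⟩
      1# * coeff p n                               ≈⟨ *-identityˡ _ ⟩
      coeff p n                                    ∎

    ι[1+n]*-cancelˡ : ∀ n {x y} → ι (suc n) * x ≈ ι (suc n) * y → x ≈ y
    ι[1+n]*-cancelˡ n {x} {y} e = begin
      x                                       ≈⟨ trans (*-congʳ (ι[1+n]⁻¹*ι[1+n] n)) (*-identityˡ x) ⟨
      (ι (suc n) ⁻¹ * ι (suc n)) * x          ≈⟨ *-assoc _ _ _ ⟩
      ι (suc n) ⁻¹ * (ι (suc n) * x)          ≈⟨ *-congˡ e ⟩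
      ι (suc n) ⁻¹ * (ι (suc n) * y)          ≈⟨ *-assoc _ _ _ ⟨
      (ι (suc n) ⁻¹ * ι (suc n)) * y          ≈⟨ trans (*-congʳ (ι[1+n]⁻¹*ι[1+n] n)) (*-identityˡ y) ⟩
      y                                       ∎

    deriv-injective : ∀ p q → deriv p ≈ₚ deriv q → coeff p 0 ≈ coeff q 0 → p ≈ₚ q
    deriv-injective p q p′≈q′ p₀≈q₀ zero    = p₀≈q₀
    deriv-injective p q p′≈q′ p₀≈q₀ (suc n) =
      ι[1+n]*-cancelˡ n (trans (sym (coeff-deriv p n)) (trans (p′≈q′ n) (coeff-deriv q n)))

module Appell {c ℓ : Level} (F : Field c ℓ) (a : ℕ → Field.Carrier F) where
  open Field F
  open FieldOps F
  open Polynomials F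
  open import Relation.Binary.Reasoning.Setoid setoid

  coeff-aPoly : ∀ m j → coeff (aPoly a m) j ≈ ι (m C j) * a (m ∸ j)
  coeff-aPoly m j = coeff-map-applyUpTo (λ j → ι (m C j) * a (m ∸ j)) (λ i → i) (suc m) j
    (λ m<j → trans (*-congʳ (ι-cong (k>n⇒nCk≡0 m<j))) (zeroˡ _))

  deriv-aPoly : ∀ m → deriv (aPoly a (suc m)) ≈ₚ scale (ι (suc m)) (aPoly a m)
  deriv-aPoly m j = begin
    coeff (deriv (aPoly a (suc m))) j                ≈⟨ trans (coeff-deriv (aPoly a (suc m)) j) (*-congˡ (coeff-aPoly (suc m) (suc j))) ⟩
    ι (suc j) * (ι (suc m C suc j) * a (m ∸ j))      ≈⟨ *-assoc _ _ _ ⟨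
    (ι (suc j) * ι (suc m C suc j)) * a (m ∸ j)      ≈⟨ *-congʳ (trans (sym (ι-* (suc j) (suc m C suc j)))
                                                          (trans (ι-cong ([k+1]*[n+1]C[k+1]≡[n+1]*nCk m j)) (ι-* (suc m) (m C j)))) ⟩
    (ι (suc m) * ι (m C j)) * a (m ∸ j)              ≈⟨ *-assoc _ _ _ ⟩
    ι (suc m) * (ι (m C j) * a (m ∸ j))              ≈⟨ trans (coeff-scale (ι (suc m)) (aPoly a m) j) (*-congˡ (coeff-aPoly m j)) ⟨
    coeff (scale (ι (suc m)) (aPoly a m)) j          ∎

  open LinearExtension (aPoly a)

  gD-linearFrom : ∀ g s p → (∀ i → g i ≡ s ℕ.+ i) →
    sumP (zipWith (λ i k → scale k (aPoly a i)) (applyUpTo g (length p)) p) ≈ₚ linearFrom s p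
  gD-linearFrom g s []      g≡s+ n = refl
  gD-linearFrom g s (x ∷ p) g≡s+ =
    ⊕-cong (scale x (aPoly a (g 0))) (scale x (aPoly a s))
           (sumP (zipWith (λ i k → scale k (aPoly a i)) (applyUpTo (g ∘ suc) (length p)) p)) (linearFrom (suc s) p)
           (λ n → reflexive (≡.cong (λ i → coeff (scale x (aPoly a i)) n) (≡.trans (g≡s+ 0) (ℕ.+-identityʳ s))))
           (gD-linearFrom (g ∘ suc) (suc s) p (λ i → ≡.trans (g≡s+ (suc i)) (ℕ.+-suc s i)))

  ⟨gD∣⟩-linearFrom : ∀ g s p → (∀ i → g i ≡ s ℕ.+ i) →
    sumK (zipWith (λ i k → k * a i) (applyUpTo g (length p)) p) ≈ coeff (linearFrom s p) 0
  ⟨gD∣⟩-linearFrom g s []      g≡s+ = refl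
  ⟨gD∣⟩-linearFrom g s (x ∷ p) g≡s+ = begin
    x * a (g 0) + sumK (zipWith (λ i k → k * a i) (applyUpTo (g ∘ suc) (length p)) p)
      ≈⟨ +-cong (*-congˡ (reflexive (≡.cong a (≡.trans (g≡s+ 0) (ℕ.+-identityʳ s)))))
                (⟨gD∣⟩-linearFrom (g ∘ suc) (suc s) p (λ i → ≡.trans (g≡s+ (suc i)) (ℕ.+-suc s i))) ⟩
    x * a s + coeff (linearFrom (suc s) p) 0
      ≈⟨ +-congʳ (*-congˡ (trans (*-congʳ (+-identityʳ 1#)) (*-identityˡ (a s)))) ⟨
    x * coeff (aPoly a s) 0 + coeff (linearFrom (suc s) p) 0
      ≈⟨ coeff-linearFrom-∷ s x p 0 ⟨
    coeff (linearFrom s (x ∷ p)) 0 ∎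

  gD≈linearFrom : ∀ p → gD a p ≈ₚ linearFrom 0 p
  gD≈linearFrom p = gD-linearFrom (λ i → i) 0 p (λ _ → ≡.refl)

  ⟨gD∣⟩≈coeff₀ : ∀ p → ⟨gD∣ a ⟩ p ≈ coeff (gD a p) 0
  ⟨gD∣⟩≈coeff₀ p = trans (⟨gD∣⟩-linearFrom (λ i → i) 0 p (λ _ → ≡.refl)) (sym (gD≈linearFrom p 0))

  gD-cong : ∀ p q → p ≈ₚ q → gD a p ≈ₚ gD a q
  gD-cong p q p≈q n = trans (gD≈linearFrom p n) (trans (linearFrom-cong 0 p q p≈q n) (sym (gD≈linearFrom q n)))

  gD-⊕ : ∀ p q → gD a (p ⊕ q) ≈ₚ (gD a p ⊕ gD a q)
  gD-⊕ p q n = trans (gD≈linearFrom (p ⊕ q) n) (trans (linearFrom-⊕ 0 p q n)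
    (sym (⊕-cong (gD a p) (linearFrom 0 p) (gD a q) (linearFrom 0 q) (gD≈linearFrom p) (gD≈linearFrom q) n)))

  gD-scale : ∀ k p → gD a (scale k p) ≈ₚ scale k (gD a p)
  gD-scale k p n = trans (gD≈linearFrom (scale k p) n) (trans (linearFrom-scale 0 k p n)
    (sym (scale-cong k k (gD a p) (linearFrom 0 p) refl (gD≈linearFrom p) n)))

  gD-∑ₚ : ∀ {b} {B : Set b} (xs : List B) f → gD a (∑ₚ xs f) ≈ₚ ∑ₚ xs (gD a ∘ f)
  gD-∑ₚ []       f n = refl
  gD-∑ₚ (x ∷ xs) f n = trans (gD-⊕ (f x) (∑ₚ xs f) n)
    (⊕-cong (gD a (f x)) (gD a (f x)) (gD a (∑ₚ xs f)) (∑ₚ xs (gD a ∘ f)) (λ _ → refl) (gD-∑ₚ xs f) n)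

  deriv-gD : ∀ p → deriv (gD a p) ≈ₚ gD a (deriv p)
  deriv-gD p n = begin
    coeff (deriv (gD a p)) n              ≈⟨ deriv-cong (gD a p) (linearFrom 0 p) (gD≈linearFrom p) n ⟩
    coeff (deriv (linearFrom 0 p)) n      ≈⟨ deriv-linearFrom-0 deriv-aPoly (λ _ → refl) p n ⟩
    coeff (linearFrom 0 (deriv p)) n      ≈⟨ gD≈linearFrom (deriv p) n ⟨
    coeff (gD a (deriv p)) n              ∎

  ⟨gD∣⟩-cong : ∀ p q → p ≈ₚ q → ⟨gD∣ a ⟩ p ≈ ⟨gD∣ a ⟩ q
  ⟨gD∣⟩-cong p q p≈q = trans (⟨gD∣⟩≈coeff₀ p) (trans (gD-cong p q p≈q 0) (sym (⟨gD∣⟩≈coeff₀ q)))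

  ⟨gD∣⟩-scale : ∀ k p → ⟨gD∣ a ⟩ (scale k p) ≈ k * ⟨gD∣ a ⟩ p
  ⟨gD∣⟩-scale k p = begin
    ⟨gD∣ a ⟩ (scale k p)             ≈⟨ trans (⟨gD∣⟩≈coeff₀ (scale k p)) (gD-scale k p 0) ⟩
    coeff (scale k (gD a p)) 0       ≈⟨ trans (coeff-scale k (gD a p) 0) (*-congˡ (sym (⟨gD∣⟩≈coeff₀ p))) ⟩
    k * ⟨gD∣ a ⟩ p                   ∎

module ClassSums {c ℓ : Level} (F : Field c ℓ) where
  open Field F
  open FieldOps F
  open Polynomials F
  open ListSum commutativeSemiring
  open import Relation.Binary.Reasoning.Setoid setoid

  module _ (U : Tree) (w : Tree → Carrier) (w-resp-≅ : ∀ T → T ≅ U → w T ≈ w U) where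

    weighted : Tree → Carrier
    weighted T = ι (isoCount T U) * w T

    weighted-≇ : ∀ T → T ≅ᵇ U ≡ false → weighted T ≈ 0#
    weighted-≇ T T≇U = trans (*-congʳ (ι-cong (≇ᵇ⇒isoCount≡0 T U T≇U))) (zeroˡ _)

    weighted-≅ : ∀ T → T ≅ U → weighted T ≈ ι (autCount U) * w U
    weighted-≅ T T≅U = *-cong (ι-cong (≅⇒isoCount≡ T U U T≅U)) (w-resp-≅ T T≅U)

    -- Removing duplicates keeps exactly one representative of the class of U.
    ∑-deduplicate : ∀ L → Any (_≅ U) L → ∑ (deduplicateᵇ _≅ᵇ_ L) weighted ≈ ι (autCount U) * w U
    ∑-deduplicate (x ∷ xs) U∈x∷xs with x ≅ᵇ U in x≅ᵇU
    ... | true  = trans (+-cong (weighted-≅ x x≅U) (∑-zeroᴬ (All.map others≈0 (All.all-filter _ (deduplicateᵇ _≅ᵇ_ xs)))))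
                        (+-identityʳ _)
      where
      x≅U = ≅ᵇ⇒≅ x U x≅ᵇU
      others≈0 : ∀ {y} → ¬ IsTrue (x ≅ᵇ y) → weighted y ≈ 0#
      others≈0 {y} x≇y with y ≅ᵇ U in y≅ᵇU
      ... | true  = ⊥-elim (x≇y (≅⇒IsTrue x y (≅-trans x U y x≅U (≅-sym y U (≅ᵇ⇒≅ y U y≅ᵇU)))))
      ... | false = weighted-≇ y y≅ᵇU
    ... | false = begin
      weighted x + ∑ (filter _ (deduplicateᵇ _≅ᵇ_ xs)) weighted
        ≈⟨ +-cong (weighted-≇ x x≅ᵇU) (∑-filter _ (deduplicateᵇ _≅ᵇ_ xs) weighted dropped≈0) ⟩
      0# + ∑ (deduplicateᵇ _≅ᵇ_ xs) weighted                   ≈⟨ +-identityˡ _ ⟩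
      ∑ (deduplicateᵇ _≅ᵇ_ xs) weighted                        ≈⟨ ∑-deduplicate xs (tail U∈x∷xs) ⟩
      ι (autCount U) * w U                                     ∎
      where
      x≇U : ¬ x ≅ U
      x≇U x≅U = case (≡.trans (≡.sym (≅⇒≅ᵇ x U x≅U)) x≅ᵇU) of λ ()
      dropped≈0 : ∀ y → ¬ ¬ IsTrue (x ≅ᵇ y) → weighted y ≈ 0#
      dropped≈0 y x≅y with y ≅ᵇ U in y≅ᵇU
      ... | true  = ⊥-elim (x≅y (λ x≅ᵇy → x≇U (≅-trans x y U (IsTrue⇒≅ x y x≅ᵇy) (≅ᵇ⇒≅ y U y≅ᵇU))))
      ... | false = weighted-≇ y y≅ᵇU
      tail : Any (_≅ U) (x ∷ xs) → Any (_≅ U) xs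
      tail (here x≅U)  = ⊥-elim (x≇U x≅U)
      tail (there U∈xs) = U∈xs

    ∑-classes-≢ : ∀ l → ¬ l ≡ size U → ∑ (classes l) weighted ≈ 0#
    ∑-classes-≢ l l≢U = ∑-zeroᴬ (All.map (λ {T} T≡l → trans (*-congʳ (ι-cong (T≇U T T≡l))) (zeroˡ _)) (classes-size l))
      where
      T≇U : ∀ T → size T ≡ l → isoCount T U ≡ 0
      T≇U T T≡l = decidable-stable (isoCount T U ℕ.≟ 0) (λ T≅U → l≢U (≡.trans (≡.sym T≡l) (≅⇒size≡ T U T≅U)))

    ∑-allClasses : ∀ N → size U < N → ∑ (allClasses N) weighted ≈ ι (autCount U) * w U
    ∑-allClasses N U<N = begin
      ∑ (allClasses N) weighted                            ≈⟨ ∑-concatMap classes (upTo N) weighted ⟩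
      ∑ (upTo N) (λ l → ∑ (classes l) weighted)            ≈⟨ ∑-applyUpTo-single _ (λ l → l) N U<N (λ _ l≢U → ∑-classes-≢ _ l≢U) ⟩
      ∑ (classes (size U)) weighted                        ≈⟨ ∑-deduplicate (trees (size U)) (Any.map (λ { ≡.refl → ≅-refl U }) (∈-trees U)) ⟩
      ι (autCount U) * w U                                 ∎

module TreeODE {c ℓ : Level} (F : Field c ℓ) (a : ℕ → Field.Carrier F) where
  open Field F
  open FieldOps F
  open Polynomials F
  open TreeSeries F
  open Appell F a
  open ListSum commutativeSemiring
  open import Relation.Binary.Reasoning.Setoid setoid

  -- P′ = ⟨g(D)|P⟩ ↷ P, read off at a single tree X through the cuts of X.
  CutODE : (Tree → Poly) → Set ℓ
  CutODE p = ∀ X → deriv (p X) ≈ₚ ∑ₚ (cuts X) (λ (A , B) → scale (⟨gD∣ a ⟩ (p A)) (p B))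

  mutual
    treePoly : Tree → Poly
    treePoly (node ts) = forestPoly ts

    forestPoly : List Tree → Poly
    forestPoly []       = onePoly
    forestPoly (t ∷ ts) = plantedPoly t ⊗ forestPoly ts

    plantedPoly : Tree → Poly
    plantedPoly t = integ (gD a (treePoly t))

  treePoly-planted : ∀ T → treePoly ⟨ T ∷ [] ∣•⟩ ≈ₚ plantedPoly T
  treePoly-planted T = ⊗-identityʳ (plantedPoly T)

  forestPoly≈prodP : ∀ ts → forestPoly ts ≈ₚ prodP (map (λ T → treePoly ⟨ T ∷ [] ∣•⟩) ts)
  forestPoly≈prodP []       n = refl
  forestPoly≈prodP (t ∷ ts) n = trans
    (⊗-congʳ (plantedPoly t) (forestPoly ts) (prodP (map (λ T → treePoly ⟨ T ∷ [] ∣•⟩) ts)) (forestPoly≈prodP ts) n)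
    (⊗-congˡ (plantedPoly t) (treePoly ⟨ t ∷ [] ∣•⟩) (prodP (map (λ T → treePoly ⟨ T ∷ [] ∣•⟩) ts)) (λ m → sym (treePoly-planted t m)) n)

  treePoly-relationI : RelationI treePoly
  treePoly-relationI T₁ ts = forestPoly≈prodP (T₁ ∷ ts)

  treePoly-relationII : RelationII a treePoly
  treePoly-relationII T = treePoly-planted T

  module _ (q : Tree → Poly) (q• : q • ≈ₚ onePoly) (qI : RelationI q) (qII : RelationII a q) where

    mutual
      relations⇒≈treePoly : ∀ T → q T ≈ₚ treePoly T
      relations⇒≈treePoly (node [])       = q•
      relations⇒≈treePoly (node (t ∷ ts)) n = trans (qI t ts n) (prodP≈forestPoly (t ∷ ts) n)

      prodP≈forestPoly : ∀ ts → prodP (map (λ T → q ⟨ T ∷ [] ∣•⟩) ts) ≈ₚ forestPoly ts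
      prodP≈forestPoly []       n = refl
      prodP≈forestPoly (t ∷ ts) n = trans
        (⊗-congʳ (q ⟨ t ∷ [] ∣•⟩) (prodP (map (λ T → q ⟨ T ∷ [] ∣•⟩) ts)) (forestPoly ts) (prodP≈forestPoly ts) n)
        (⊗-congˡ (q ⟨ t ∷ [] ∣•⟩) (plantedPoly t) (forestPoly ts)
          (λ m → trans (qII t m) (integ-cong (gD a (q t)) (gD a (treePoly t)) (gD-cong (q t) (treePoly t) (relations⇒≈treePoly t)) m)) n)

  treePoly-coeff₀ : ∀ X → coeff (treePoly X) 0 ≈ (if X ≅ᵇ • then 1# else 0#)
  treePoly-coeff₀ (node [])       = refl
  treePoly-coeff₀ (node (t ∷ ts)) = coeff₀-integ-⊗ (gD a (treePoly t)) (forestPoly ts)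

  normalise-coeff₀ : ∀ P → InitialBullet P → ∀ X → coeff (normalise P X) 0 ≈ coeff (treePoly X) 0
  normalise-coeff₀ P init X = begin
    coeff (scale (ι (autCount X)) (P X)) 0            ≈⟨ coeff-scale _ (P X) 0 ⟩
    ι (autCount X) * coeff (P X) 0                    ≈⟨ *-congˡ (trans (sym (eval-0 (P X))) (init X)) ⟩
    ι (autCount X) * (if X ≅ᵇ • then 1# else 0#)      ≈⟨ aut*δ X ⟩
    (if X ≅ᵇ • then 1# else 0#)                       ≈⟨ treePoly-coeff₀ X ⟨
    coeff (treePoly X) 0                              ∎
    where
    aut*δ : ∀ X → ι (autCount X) * (if X ≅ᵇ • then 1# else 0#) ≈ (if X ≅ᵇ • then 1# else 0#)
    aut*δ (node [])      = trans (*-identityʳ _) (+-identityʳ 1#)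
    aut*δ (node (_ ∷ _)) = zeroʳ _

  RelationI-resp : ∀ p q → (∀ T → p T ≈ₚ q T) → RelationI p → RelationI q
  RelationI-resp p q p≈q pI T₁ ts n = begin
    coeff (q ⟨ T₁ ∷ ts ∣•⟩) n                                      ≈⟨ sym (p≈q ⟨ T₁ ∷ ts ∣•⟩ n) ⟩
    coeff (p ⟨ T₁ ∷ ts ∣•⟩) n                                      ≈⟨ pI T₁ ts n ⟩
    coeff (prodP (map (λ T → p ⟨ T ∷ [] ∣•⟩) (T₁ ∷ ts))) n
      ≈⟨ prodP-cong (T₁ ∷ ts) (λ T → p ⟨ T ∷ [] ∣•⟩) (λ T → q ⟨ T ∷ [] ∣•⟩) (λ T → p≈q ⟨ T ∷ [] ∣•⟩) n ⟩
    coeff (prodP (map (λ T → q ⟨ T ∷ [] ∣•⟩) (T₁ ∷ ts))) n         ∎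

  RelationII-resp : ∀ p q → (∀ T → p T ≈ₚ q T) → RelationII a p → RelationII a q
  RelationII-resp p q p≈q pII T n = begin
    coeff (q ⟨ T ∷ [] ∣•⟩) n              ≈⟨ sym (p≈q ⟨ T ∷ [] ∣•⟩ n) ⟩
    coeff (p ⟨ T ∷ [] ∣•⟩) n              ≈⟨ pII T n ⟩
    coeff (integ (gD a (p T))) n          ≈⟨ integ-cong (gD a (p T)) (gD a (q T)) (gD-cong (p T) (q T) (p≈q T)) n ⟩
    coeff (integ (gD a (q T))) n          ∎

  module _ (charZero : CharZero) where
    open CharacteristicZero charZero

    CutODE-unique : ∀ p q → CutODE p → CutODE q → (∀ X → coeff (p X) 0 ≈ coeff (q X) 0) → ∀ X → p X ≈ₚ q X
    CutODE-unique p q p′ q′ p₀≈q₀ X = go (size X) X ℕ.≤-refl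
      where
      go : ∀ m X → size X ≤ m → p X ≈ₚ q X
      go (suc m) X X≤1+m = deriv-injective (p X) (q X) p′≈q′ (p₀≈q₀ X)
        where
        p′≈q′ : deriv (p X) ≈ₚ deriv (q X)
        p′≈q′ n = trans (p′ X n) (trans (∑ₚ-congᴬ (All.map (λ {(A , B)} (A<X , B<X) →
            scale-cong _ _ (p B) (q B) (⟨gD∣⟩-cong (p A) (q A) (go m A (<⇒≤m A<X))) (go m B (<⇒≤m B<X)))
          (cuts-size< X)) n) (sym (q′ X n)))
          where
          <⇒≤m : ∀ {k} → k < size X → k ≤ m
          <⇒≤m k<X = ℕ.≤-pred (ℕ.≤-trans k<X X≤1+m)
      go zero (node _) ()

    cutSumF : List Tree → Poly
    cutSumF ss = ∑ₚ (cutsF ss) (λ (x , r) → scale (⟨gD∣ a ⟩ (treePoly x)) (forestPoly r))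

    plantedCutSumF : List Tree → Poly
    plantedCutSumF cs = ∑ₚ (cutsF cs) (λ (x , r) → scale (⟨gD∣ a ⟩ (treePoly x)) (plantedPoly (node r)))

    -- g(D) q has derivative g(D) q′ and constant term ⟨g(D)|q⟩.
    gD-forestPoly : ∀ cs → deriv (forestPoly cs) ≈ₚ cutSumF cs →
      gD a (forestPoly cs) ≈ₚ ((⟨gD∣ a ⟩ (forestPoly cs) ∷ []) ⊕ plantedCutSumF cs)
    gD-forestPoly cs q′≈ = deriv-injective (gD a (forestPoly cs)) rhs derivs constants
      where
      h : Tree × List Tree → Poly
      h (x , r) = scale (⟨gD∣ a ⟩ (treePoly x)) (plantedPoly (node r))
      rhs = (⟨gD∣ a ⟩ (forestPoly cs) ∷ []) ⊕ ∑ₚ (cutsF cs) h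
      derivs : deriv (gD a (forestPoly cs)) ≈ₚ deriv rhs
      derivs n = begin
        coeff (deriv (gD a (forestPoly cs))) n  ≈⟨ deriv-gD (forestPoly cs) n ⟩
        coeff (gD a (deriv (forestPoly cs))) n  ≈⟨ gD-cong (deriv (forestPoly cs)) (cutSumF cs) q′≈ n ⟩
        coeff (gD a (cutSumF cs)) n             ≈⟨ gD-∑ₚ (cutsF cs) _ n ⟩
        coeff (∑ₚ (cutsF cs) (λ (x , r) → gD a (scale (⟨gD∣ a ⟩ (treePoly x)) (forestPoly r)))) n
          ≈⟨ ∑ₚ-cong (cutsF cs) (λ (x , r) m → trans (gD-scale (⟨gD∣ a ⟩ (treePoly x)) (forestPoly r) m)
                (sym (trans (deriv-scale (⟨gD∣ a ⟩ (treePoly x)) (plantedPoly (node r)) m)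
                   (scale-cong _ _ (deriv (plantedPoly (node r))) (gD a (forestPoly r)) refl (deriv-integ (gD a (forestPoly r))) m)))) n ⟩
        coeff (∑ₚ (cutsF cs) (deriv ∘ h)) n     ≈⟨ deriv-∑ₚ (cutsF cs) h n ⟨
        coeff (deriv (∑ₚ (cutsF cs) h)) n       ≈⟨ deriv-⊕ (⟨gD∣ a ⟩ (forestPoly cs) ∷ []) (∑ₚ (cutsF cs) h) n ⟨
        coeff (deriv rhs) n                     ∎
      constants : coeff (gD a (forestPoly cs)) 0 ≈ coeff rhs 0
      constants = begin
        coeff (gD a (forestPoly cs)) 0
          ≈⟨ trans (sym (⟨gD∣⟩≈coeff₀ (forestPoly cs))) (sym (+-identityʳ _)) ⟩
        ⟨gD∣ a ⟩ (forestPoly cs) + 0#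
          ≈⟨ +-congˡ (∑-zero (cutsF cs) (λ (x , r) → trans (coeff-scale _ (plantedPoly (node r)) 0) (zeroʳ _))) ⟨
        ⟨gD∣ a ⟩ (forestPoly cs) + ∑ (cutsF cs) (λ e → coeff (h e) 0)
          ≈⟨ trans (coeff-⊕ (⟨gD∣ a ⟩ (forestPoly cs) ∷ []) (∑ₚ (cutsF cs) h) 0) (+-congˡ (coeff-∑ₚ (cutsF cs) h 0)) ⟨
        coeff rhs 0 ∎

    cutSumF-∷ : ∀ cs ss → cutSumF (node cs ∷ ss) ≈ₚ
      (scale (⟨gD∣ a ⟩ (forestPoly cs)) (forestPoly ss) ⊕
        (∑ₚ (cutsF cs) (λ (x , r) → scale (⟨gD∣ a ⟩ (treePoly x)) (plantedPoly (node r) ⊗ forestPoly ss)) ⊕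
         ∑ₚ (cutsF ss) (λ (x , r) → scale (⟨gD∣ a ⟩ (treePoly x)) (plantedPoly (node cs) ⊗ forestPoly r))))
    cutSumF-∷ cs ss = ⊕-cong (G (node cs , ss)) (G (node cs , ss)) _ _ (λ _ → refl) λ m →
      trans (∑ₚ-++ (map f₁ (cuts (node cs))) (map f₂ (cutsF ss)) G m)
        (reflexive (≡.cong₂ (λ u v → coeff (u ⊕ v) m)
          (≡.trans (∑ₚ-map f₁ (cuts (node cs)) G) (∑ₚ-map _ (cutsF cs) (G ∘ f₁))) (∑ₚ-map f₂ (cutsF ss) G)))
      where
      G : Tree × List Tree → Poly
      G (x , r) = scale (⟨gD∣ a ⟩ (treePoly x)) (forestPoly r)
      f₁ : Tree × Tree → Tree × List Tree
      f₁ (x , y) = x , y ∷ ss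
      f₂ : Tree × List Tree → Tree × List Tree
      f₂ (x , r) = x , node cs ∷ r

    forestPoly-deriv : ∀ ss → deriv (forestPoly ss) ≈ₚ cutSumF ss
    forestPoly-deriv []                  n = refl
    forestPoly-deriv (s@(node cs) ∷ ss) n = begin
      coeff (deriv (plantedPoly s ⊗ forestPoly ss)) n
        ≈⟨ deriv-⊗ (plantedPoly s) (forestPoly ss) n ⟩
      coeff ((deriv (plantedPoly s) ⊗ forestPoly ss) ⊕ (plantedPoly s ⊗ deriv (forestPoly ss))) n
        ≈⟨ ⊕-cong (deriv (plantedPoly s) ⊗ forestPoly ss) ((planted₀ ⊗ forestPoly ss) ⊕ (plantedCutSumF cs ⊗ forestPoly ss))
                  (plantedPoly s ⊗ deriv (forestPoly ss)) cutsOutside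
             (λ m → trans (⊗-congˡ (deriv (plantedPoly s)) (planted₀ ⊕ plantedCutSumF cs) (forestPoly ss) planted′ m)
                          (⊗-distribʳ-⊕ planted₀ (plantedCutSumF cs) (forestPoly ss) m))
             (λ m → trans (⊗-congʳ (plantedPoly s) (deriv (forestPoly ss)) (cutSumF ss) (forestPoly-deriv ss) m)
                (trans (⊗-distribˡ-∑ₚ (plantedPoly s) (cutsF ss) (λ (x , r) → scale (k x) (forestPoly r)) m)
                  (∑ₚ-cong (cutsF ss) (λ (x , r) → ⊗-scaleʳ (k x) (plantedPoly s) (forestPoly r)) m))) n ⟩
      coeff (((planted₀ ⊗ forestPoly ss) ⊕ (plantedCutSumF cs ⊗ forestPoly ss)) ⊕ cutsOutside) n
        ≈⟨ ⊕-assoc (planted₀ ⊗ forestPoly ss) (plantedCutSumF cs ⊗ forestPoly ss) cutsOutside n ⟩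
      coeff ((planted₀ ⊗ forestPoly ss) ⊕ ((plantedCutSumF cs ⊗ forestPoly ss) ⊕ cutsOutside)) n
        ≈⟨ ⊕-cong (planted₀ ⊗ forestPoly ss) (scale (k s) (forestPoly ss)) ((plantedCutSumF cs ⊗ forestPoly ss) ⊕ cutsOutside) (cutsInside ⊕ cutsOutside)
             (constant-⊗ (k s) (forestPoly ss)) (⊕-cong (plantedCutSumF cs ⊗ forestPoly ss) cutsInside cutsOutside cutsOutside inside (λ _ → refl)) n ⟩
      coeff (scale (k s) (forestPoly ss) ⊕ (cutsInside ⊕ cutsOutside)) n
        ≈⟨ cutSumF-∷ cs ss n ⟨
      coeff (cutSumF (s ∷ ss)) n ∎
      where
      k : Tree → Carrier
      k x = ⟨gD∣ a ⟩ (treePoly x)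
      planted₀ = ⟨gD∣ a ⟩ (forestPoly cs) ∷ []
      planted′ : deriv (plantedPoly s) ≈ₚ (planted₀ ⊕ plantedCutSumF cs)
      planted′ m = trans (deriv-integ (gD a (forestPoly cs)) m) (gD-forestPoly cs (forestPoly-deriv cs) m)
      cutsOutside = ∑ₚ (cutsF ss) (λ (x , r) → scale (k x) (plantedPoly s ⊗ forestPoly r))
      cutsInside = ∑ₚ (cutsF cs) (λ (x , r) → scale (k x) (plantedPoly (node r) ⊗ forestPoly ss))
      inside : (plantedCutSumF cs ⊗ forestPoly ss) ≈ₚ cutsInside
      inside m = trans (⊗-distribʳ-∑ₚ (cutsF cs) (λ (x , r) → scale (k x) (plantedPoly (node r))) (forestPoly ss) m)
        (∑ₚ-cong (cutsF cs) (λ (x , r) → ⊗-scaleˡ (k x) (plantedPoly (node r)) (forestPoly ss)) m)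

    treePoly-cutODE : CutODE treePoly
    treePoly-cutODE (node ss) n = trans (forestPoly-deriv ss n)
      (reflexive (≡.cong (λ r → coeff r n) (≡.sym (∑ₚ-map _ (cutsF ss) (λ (A , B) → scale (⟨gD∣ a ⟩ (treePoly A)) (treePoly B))))))

module GraftSeries {c ℓ : Level} (F : Field c ℓ) where
  open Field F
  open FieldOps F
  open TreeSeries F
  open Polynomials F
  open ListSum commutativeSemiring
  open import Relation.Binary.Reasoning.Setoid setoid

  coeff-graftSeries : ∀ A B S n → let N = suc (size S) in
    coeff (graftSeries A B S) n ≈ ∑ (allClasses N) (λ T → ∑ (allClasses N) (λ T′ → (A T * ι (graftCoeff T T′ S)) * coeff (B T′) n))
  coeff-graftSeries A B S n = begin
    coeff (graftSeries A B S) n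
      ≈⟨ coeff-sumP (concatMap (λ k → concatMap (terms k) Ns) Ns) n ⟩
    ∑ (concatMap (λ k → concatMap (terms k) Ns) Ns) cfn
      ≈⟨ trans (∑-concatMap (λ k → concatMap (terms k) Ns) Ns cfn) (∑-cong Ns (λ k → trans (∑-concatMap (terms k) Ns cfn) (∑-cong Ns (λ l →
           trans (∑-concatMap (λ T → map (summand T) (classes l)) (classes k) cfn) (∑-cong (classes k) (λ T →
             trans (reflexive (∑-map (summand T) (classes l) cfn)) (∑-cong (classes l) (λ T′ → coeff-scale _ (B T′) n)))))))) ⟩
    ∑ Ns (λ k → ∑ Ns (λ l → ∑ (classes k) (λ T → ∑ (classes l) (λ T′ → term T T′))))
      ≈⟨ ∑-cong Ns (λ k → ∑-comm Ns (classes k) (λ l T → ∑ (classes l) (λ T′ → term T T′))) ⟩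
    ∑ Ns (λ k → ∑ (classes k) (λ T → ∑ Ns (λ l → ∑ (classes l) (λ T′ → term T T′))))
      ≈⟨ trans (∑-concatMap classes Ns _) (∑-cong Ns (λ k → ∑-cong (classes k) (λ T → ∑-concatMap classes Ns (term T)))) ⟨
    ∑ (allClasses N) (λ T → ∑ (allClasses N) (term T)) ∎
    where
    N = suc (size S)
    Ns = upTo N
    term : Tree → Tree → Carrier
    term T T′ = (A T * ι (graftCoeff T T′ S)) * coeff (B T′) n
    summand : Tree → Tree → Poly
    summand T T′ = scale (A T * ι (graftCoeff T T′ S)) (B T′)
    terms : ℕ → ℕ → List Poly
    terms k l = concatMap (λ T → map (summand T) (classes l)) (classes k)
    cfn : Poly → Carrier
    cfn q = coeff q n

  module _ (a : ℕ → Carrier) (P : Tree → Poly) (P-resp-≅ : ClassFunction P) (ode : SolvesODE a P) where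
    open Appell F a
    open TreeODE F a using (CutODE)
    open ClassSums F

    private
      α : Tree → Carrier
      α T = ⟨gD∣ a ⟩ (P T)

    graft-term : ∀ T T′ X n →
      ι (autCount X) * ((α T * ι (graftCoeff T T′ X)) * coeff (P T′) n) ≈
      ∑ (cuts X) (λ (A , B) → (α T * ι (isoCount T A)) * (ι (isoCount T′ B) * coeff (P T′) n))
    graft-term T T′ X n = begin
      k * ((α T * ι (graftCoeff T T′ X)) * coeff (P T′) n)
        ≈⟨ trans (sym (*-assoc _ _ _)) (*-congʳ (trans (*-comm _ _) (*-assoc _ _ _))) ⟩
      (α T * (ι (graftCoeff T T′ X) * k)) * coeff (P T′) n
        ≈⟨ *-congʳ (*-congˡ (trans (sym (ι-* (graftCoeff T T′ X) (autCount X))) (ι-cong (graftCoeff*autCount T T′ X)))) ⟩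
      (α T * ι (ℕ∑.∑ (cuts X) (λ (A , B) → isoCount T A ℕ.* isoCount T′ B))) * coeff (P T′) n
        ≈⟨ *-congʳ (*-congˡ (trans (ι-∑ (cuts X) _) (∑-cong (cuts X) (λ (A , B) → ι-* (isoCount T A) (isoCount T′ B))))) ⟩
      (α T * ∑ (cuts X) (λ (A , B) → ι (isoCount T A) * ι (isoCount T′ B))) * coeff (P T′) n
        ≈⟨ trans (*-congʳ (*-distribˡ-∑ (α T) (cuts X) _)) (*-distribʳ-∑ _ (cuts X) _) ⟩
      ∑ (cuts X) (λ (A , B) → (α T * (ι (isoCount T A) * ι (isoCount T′ B))) * coeff (P T′) n)
        ≈⟨ ∑-cong (cuts X) (λ _ → trans (*-congʳ (sym (*-assoc _ _ _))) (*-assoc _ _ _)) ⟩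
      ∑ (cuts X) (λ (A , B) → (α T * ι (isoCount T A)) * (ι (isoCount T′ B) * coeff (P T′) n)) ∎
      where k = ι (autCount X)

    normalise-cutODE : CutODE (normalise P)
    normalise-cutODE X n = begin
      coeff (deriv (scale k (P X))) n
        ≈⟨ trans (deriv-scale k (P X) n) (coeff-scale k (deriv (P X)) n) ⟩
      k * coeff (deriv (P X)) n
        ≈⟨ *-congˡ (trans (ode X n) (coeff-graftSeries α P X n)) ⟩
      k * ∑ Cl (λ T → ∑ Cl (λ T′ → (α T * ι (graftCoeff T T′ X)) * coeff (P T′) n))
        ≈⟨ trans (*-distribˡ-∑ k Cl _) (∑-cong Cl (λ T → trans (*-distribˡ-∑ k Cl _) (∑-cong Cl (λ T′ → graft-term T T′ X n)))) ⟩
      ∑ Cl (λ T → ∑ Cl (λ T′ → ∑ (cuts X) (λ (A , B) → (α T * ι (isoCount T A)) * (ι (isoCount T′ B) * coeff (P T′) n))))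
        ≈⟨ ∑-product Cl Cl (cuts X) (λ T (A , _) → α T * ι (isoCount T A)) (λ T′ (_ , B) → ι (isoCount T′ B) * coeff (P T′) n) ⟩
      ∑ (cuts X) (λ (A , B) → ∑ Cl (λ T → α T * ι (isoCount T A)) * ∑ Cl (λ T′ → ι (isoCount T′ B) * coeff (P T′) n))
        ≈⟨ ∑-congᴬ (All.map (λ {(A , B)} (A<X , B<X) → *-cong
              (trans (∑-cong Cl (λ T → *-comm _ _)) (∑-allClasses A α (λ T T≅A → ⟨gD∣⟩-cong (P T) (P A) (P-resp-≅ T A T≅A)) N (ℕ.m<n⇒m<1+n A<X)))
              (∑-allClasses B (λ T′ → coeff (P T′) n) (λ T′ T′≅B → P-resp-≅ T′ B T′≅B n) N (ℕ.m<n⇒m<1+n B<X)))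
            (cuts-size< X)) ⟩
      ∑ (cuts X) (λ (A , B) → (ι (autCount A) * α A) * (ι (autCount B) * coeff (P B) n))
        ≈⟨ ∑-cong (cuts X) (λ (A , B) → *-cong (sym (⟨gD∣⟩-scale (ι (autCount A)) (P A))) (sym (coeff-scale _ (P B) n))) ⟩
      ∑ (cuts X) (λ (A , B) → ⟨gD∣ a ⟩ (normalise P A) * coeff (normalise P B) n)
        ≈⟨ trans (coeff-∑ₚ (cuts X) _ n) (∑-cong (cuts X) (λ (A , B) → coeff-scale _ (normalise P B) n)) ⟨
      coeff (∑ₚ (cuts X) (λ (A , B) → scale (⟨gD∣ a ⟩ (normalise P A)) (normalise P B))) n ∎
      where
      k = ι (autCount X)
      N = suc (size X)
      Cl = allClasses N

theorem2p13 : ∀ {c ℓ : Level} (F : Field c ℓ) →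
    let open Field F in let open FieldOps F in let open TreeSeries F in
    CharZero →
    (cf a : ℕ → Carrier) →
    cf 0 ≈ 0# → ¬ (cf 1 ≈ 0#) →
    (∀ n → egfProd a cf n ≈ tEGF n) →
    (P : Tree → Poly) → ClassFunction P →
    SolvesODE a P → InitialBullet P →
    (normalise P • ≈ₚ onePoly)
    × RelationI (normalise P)
    × RelationII a (normalise P)
    × (∀ (q : Tree → Poly) → q • ≈ₚ onePoly → RelationI q → RelationII a q →
         ∀ T → q T ≈ₚ normalise P T)
theorem2p13 F charZero _ a _ _ _ P P-resp-≅ ode init =
    p≈treePoly •
  , RelationI-resp treePoly p (λ T n → sym (p≈treePoly T n)) treePoly-relationI
  , RelationII-resp treePoly p (λ T n → sym (p≈treePoly T n)) treePoly-relationII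
  , λ q q• qI qII T n → trans (relations⇒≈treePoly q q• qI qII T n) (sym (p≈treePoly T n))
  where
  open Field F
  open FieldOps F
  open TreeSeries F
  open TreeODE F a
  open GraftSeries F using (normalise-cutODE)

  p = normalise P

  p≈treePoly : ∀ X → p X ≈ₚ treePoly X
  p≈treePoly = CutODE-unique charZero p treePoly
    (normalise-cutODE a P P-resp-≅ ode) (treePoly-cutODE charZero) (normalise-coeff₀ P init)
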